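{- Let $n\ge1$, $\pi\in B_n$ and let $a,b,c$ be distinct elements of $\pi[n]$. (a) If $\alpha(a,b)>0$, $\alpha(a,c)>0$ and $\alpha(b,c)>0$, then $\alpha(a,b)+\alpha(a,c)+\alpha(b,c)\le 3$. (b) If $a,b,c$ are either all positive or all negative, then $\alpha(a,b)+\alpha(a,c)+\alpha(b,c)\le 2$.
   Context: $B_n$ is the group of permutations $\pi$ of $[-n,n]\setminus\{0\}$ with $\pi(-i)=-\pi(i)$; $\pi[n]=\{\pi(1),\dots,\pi(n)\}$. Let $\ell$ be the length with respect to the generators $s_0=t_{1,-1}$, $s_i=t_{i,i+1}t_{ -i,-(i+1)}$ ($1\le i\le n-1$), $t_{x,y}$ the transposition of $x,y$. For distinct $x,y\in[-n,n]\setminus\{0\}$ define $u_{x,y}$: if $x=-y$, $u_{x,y}=t_{x,-x}$; if $xy>0$ or $\pi^{ -1}(x)\pi^{ -1}(y)>0$, $u_{x,y}=t_{x,y}t_{ -x,-y}$; otherwise $u_{x,y}$ is undefined. The graph $\Gamma_-^B(\pi)$ has vertex set $[-n,n]\setminus\{0\}$, with $\{x,y\}$ an edge iff $u_{x,y}$ is defined and $\ell(u_{x,y}\pi)=\ell(\pi)-1$. Set $e(x,y)=1$ if $x,y$ are adjacent and $0$ otherwise, $e(x,x)=0$. For $x,y\in\pi[n]$ let $\alpha(x,y)=e(x,y)+e(x,-y)$. -}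

module Defs where

open import Data.Nat using (ℕ; zero; suc; _+_; _≤_)
open import Data.Bool using (Bool; true; false; not; if_then_else_)
open import Data.Fin using (Fin; zero; suc; inject₁)
open import Data.List using (List; []; _∷_; length)
open import Data.Product using (Σ; _×_; _,_; ∃)
open import Data.Sum using (_⊎_)
open import Relation.Nullary using (¬_; Dec; yes; no)
open import Relation.Binary.PropositionalEquality using (_≡_; _≢_)
import Data.Fin.Properties as FinP
import Data.Bool.Properties as BoolP
import Data.Product.Properties as ProdP

-- Signed elements of [-n,n]∖{0}:  (true , i) is +(toℕ i + 1),  (false , i) is -(toℕ i + 1).
SE : ℕ → Set
SE n = Bool × Fin n

pos : ∀ {n} → Fin n → SE n
pos i = (true , i)

neg : ∀ {n} → SE n → SE n
neg (s , i) = (not s , i)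

_≟SE_ : ∀ {n} (x y : SE n) → Dec (x ≡ y)
_≟SE_ = ProdP.≡-dec BoolP._≟_ FinP._≟_

Pos : ∀ {n} → SE n → Set
Pos (s , _) = s ≡ true

SameSign : ∀ {n} → SE n → SE n → Set
SameSign (s , _) (t , _) = s ≡ t

t : ∀ {n} → SE n → SE n → SE n → SE n
t x y z with z ≟SE x
... | yes _ = y
... | no _ with z ≟SE y
...   | yes _ = x
...   | no _ = z

record B (n : ℕ) : Set where
  field
    fun     : SE n → SE n
    inv     : SE n → SE n
    inv-l   : ∀ x → inv (fun x) ≡ x
    inv-r   : ∀ x → fun (inv x) ≡ x
    odd     : ∀ x → fun (neg x) ≡ neg (fun x)
open B public

-- Coxeter generators of B_(suc m):
--   index zero     ↦ s_0 = t_{1,-1}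
--   index (suc j)  ↦ s_{j+1} = t_{j+1,j+2} t_{-(j+1),-(j+2)}
gen : ∀ {m} → Fin (suc m) → SE (suc m) → SE (suc m)
gen zero z = t (pos zero) (neg (pos zero)) z
gen (suc j) z = t (pos (inject₁ j)) (pos (suc j))
                  (t (neg (pos (inject₁ j))) (neg (pos (suc j))) z)

wordProd : ∀ {m} → List (Fin (suc m)) → SE (suc m) → SE (suc m)
wordProd [] z = z
wordProd (g ∷ w) z = gen g (wordProd w z)

Represents : ∀ {m} → List (Fin (suc m)) → (SE (suc m) → SE (suc m)) → Set
Represents w f = ∀ z → wordProd w z ≡ f z

HasLength : ∀ {m} → (SE (suc m) → SE (suc m)) → ℕ → Set
HasLength {m} f k =
  (Σ (List (Fin (suc m))) λ w → length w ≡ k × Represents w f)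
  × (∀ (w : List (Fin (suc m))) → Represents w f → k ≤ length w)

-- u_{x,y} as a function (the definedness condition is separate, see UDefined)
u : ∀ {n} → SE n → SE n → SE n → SE n
u x y z with x ≟SE neg y
... | yes _ = t x (neg x) z
... | no _ = t x y (t (neg x) (neg y) z)

UDefined : ∀ {n} → B n → SE n → SE n → Set
UDefined π x y = x ≡ neg y ⊎ SameSign x y ⊎ SameSign (inv π x) (inv π y)

Adj : ∀ {m} → B (suc m) → SE (suc m) → SE (suc m) → Set
Adj π x y = x ≢ y × UDefined π x y
  × ∃ λ k → HasLength (fun π) (suc k) × HasLength (λ z → u x y (fun π z)) k

-- EVal π x y v :  v = e(x,y)  (1 if adjacent, 0 otherwise; e(x,x) = 0 since Adj needs x ≢ y)
EVal : ∀ {m} → B (suc m) → SE (suc m) → SE (suc m) → ℕ → Set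
EVal π x y v = (Adj π x y × v ≡ 1) ⊎ (¬ Adj π x y × v ≡ 0)

InImage : ∀ {n} → B n → SE n → Set
InImage π x = ∃ λ i → fun π (pos i) ≡ x

-- Number [-n, n] ∖ {0} by keys 0, …, 2n - 1 in increasing order; negation becomes k ↦ 2n - 1 - k and
-- π⁻¹ becomes an odd permutation h of the keys.  Twice the length of π is inv(h) plus the number of
-- positive positions carrying a negative value: a generator changes this by at most 2 and a descent
-- lowers it by exactly 2.  For an edge {x, y} (x ≢ -y), u_(x,y) is a pair of mirrored transpositions
-- lowering the inversion count by exactly 2, which is only possible when the keys of x and y satisfy
-- the Bruhat covering condition: an inversion of h with no entry between them in position and value.
-- Both parts then come from order arguments: the middle one of three pairwise covering keys would lie
-- in such a forbidden window, and so would a third element of π[n] joined to both x and y when x and y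
-- carry both edges {x, y} and {x, -y}.  For elements of the same sign only edges {x, y} can occur.

module Submission where

open import Defs
open import Data.Bool using (true; false; not)
open import Data.Empty using (⊥; ⊥-elim)
open import Data.Fin using (Fin; toℕ; fromℕ<; inject₁) renaming (zero to fzero; suc to fsuc)
open import Data.Fin.Properties using (toℕ<n; toℕ-fromℕ<; toℕ-injective; toℕ-inject₁; any?)
open import Data.List using (List; []; _∷_; _++_; [_]; map; length)
open import Data.List.Membership.Propositional using (_∈_)
open import Data.List.Membership.Propositional.Properties using (∈-map⁺)
open import Data.List.Properties using (map-++; map-cong; map-id)
open import Data.List.Relation.Unary.Any using (here; there)
open import Data.Nat using (ℕ; zero; suc; _+_; _∸_; _*_; _≤_; _<_; z≤n; s≤s; s≤s⁻¹; _≟_; _<?_; _≤?_)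
open import Data.Nat.Properties
open import Data.Nat.Tactic.RingSolver using (solve-∀)
open import Data.Product using (Σ; ∃; _×_; _,_; proj₁; proj₂)
open import Data.Sum using (_⊎_; inj₁; inj₂)
import Data.Sum as Sum
open import Function using (_∘_; id)
open import Relation.Binary.Definitions using (tri<; tri≈; tri>)
open import Relation.Binary.PropositionalEquality
  using (_≡_; _≢_; refl; sym; trans; cong; cong₂; subst; subst₂; ≢-sym; module ≡-Reasoning)
open import Relation.Nullary using (¬_; Dec; yes; no)

module Inversions where

  iverson : ∀ {P : Set} → Dec P → ℕ
  iverson (yes _) = 1
  iverson (no _) = 0

  iverson-yes : ∀ {P : Set} (d : Dec P) → P → iverson d ≡ 1
  iverson-yes (yes _) _ = refl
  iverson-yes (no ¬p) p = ⊥-elim (¬p p)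

  iverson-no : ∀ {P : Set} (d : Dec P) → ¬ P → iverson d ≡ 0
  iverson-no (yes p) ¬p = ⊥-elim (¬p p)
  iverson-no (no _) _ = refl

  iverson≤1 : ∀ {P : Set} (d : Dec P) → iverson d ≤ 1
  iverson≤1 (yes _) = ≤-refl
  iverson≤1 (no _) = z≤n

  sumOver : (ℕ → ℕ) → List ℕ → ℕ
  sumOver f [] = 0
  sumOver f (y ∷ ys) = f y + sumOver f ys

  sumOver-++ : ∀ f A B → sumOver f (A ++ B) ≡ sumOver f A + sumOver f B
  sumOver-++ f [] B = refl
  sumOver-++ f (y ∷ A) B =
    trans (cong (f y +_) (sumOver-++ f A B)) (sym (+-assoc (f y) (sumOver f A) (sumOver f B)))

  sumOver-+ : ∀ f g ys → sumOver (λ y → f y + g y) ys ≡ sumOver f ys + sumOver g ys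
  sumOver-+ f g [] = refl
  sumOver-+ f g (y ∷ ys) =
    trans (cong (f y + g y +_) (sumOver-+ f g ys)) (+-+-interchange (f y) (g y) _ _)
    where
    +-+-interchange : ∀ p q r s → p + q + (r + s) ≡ p + r + (q + s)
    +-+-interchange = solve-∀

  sumOver-2* : ∀ f ys → sumOver (λ y → 2 * f y) ys ≡ 2 * sumOver f ys
  sumOver-2* f [] = refl
  sumOver-2* f (y ∷ ys) =
    trans (cong (2 * f y +_) (sumOver-2* f ys)) (sym (*-distribˡ-+ 2 (f y) (sumOver f ys)))

  sumOver-mono : ∀ {f g} → (∀ y → f y ≤ g y) → ∀ ys → sumOver f ys ≤ sumOver g ys
  sumOver-mono le [] = z≤n
  sumOver-mono le (y ∷ ys) = +-mono-≤ (le y) (sumOver-mono le ys)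

  sumOver-cong : ∀ {f g} → (∀ y → f y ≡ g y) → ∀ ys → sumOver f ys ≡ sumOver g ys
  sumOver-cong e [] = refl
  sumOver-cong e (y ∷ ys) = cong₂ _+_ (e y) (sumOver-cong e ys)

  #below : ℕ → List ℕ → ℕ
  #below x = sumOver (λ y → iverson (y <? x))

  #above : ℕ → List ℕ → ℕ
  #above x = sumOver (λ y → iverson (x <? y))

  #between : ℕ → ℕ → List ℕ → ℕ
  #between lo hi = sumOver (λ y → iverson (lo <? y) * iverson (y <? hi))

  inversions : List ℕ → ℕ
  inversions [] = 0
  inversions (x ∷ xs) = #below x xs + inversions xs

  crossInversions : List ℕ → List ℕ → ℕ
  crossInversions A B = sumOver (λ a → #below a B) A

  #below-++ : ∀ x A B → #below x (A ++ B) ≡ #below x A + #below x B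
  #below-++ x = sumOver-++ _

  inversions-++ : ∀ A B → inversions (A ++ B) ≡ inversions A + crossInversions A B + inversions B
  inversions-++ [] B = refl
  inversions-++ (a ∷ A) B
    rewrite #below-++ a A B | inversions-++ A B = regroup (#below a A) (#below a B) (inversions A) _ _
    where
    regroup : ∀ p q r s v → p + q + (r + s + v) ≡ p + r + (q + s) + v
    regroup = solve-∀

  crossInversions-++ʳ : ∀ A B C → crossInversions A (B ++ C) ≡ crossInversions A B + crossInversions A C
  crossInversions-++ʳ A B C =
    trans (sumOver-cong (λ a → #below-++ a B C) A) (sumOver-+ (λ a → #below a B) (λ a → #below a C) A)

  crossInversions-[_] : ∀ b B → crossInversions B [ b ] ≡ #above b B
  crossInversions-[_] b = sumOver-cong (λ y → +-identityʳ (iverson (b <? y)))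

  #below-swap : ∀ x a B b C → #below x (a ∷ B ++ b ∷ C) ≡ #below x (b ∷ B ++ a ∷ C)
  #below-swap x a B b C rewrite #below-++ x B (b ∷ C) | #below-++ x B (a ∷ C) =
    exchange (iverson (a <? x)) (#below x B) (iverson (b <? x)) (#below x C)
    where
    exchange : ∀ p q r s → p + (q + (r + s)) ≡ r + (q + (p + s))
    exchange = solve-∀

  crossInversions-swap : ∀ A a B b C →
    crossInversions A (a ∷ B ++ b ∷ C) ≡ crossInversions A (b ∷ B ++ a ∷ C)
  crossInversions-swap A a B b C = sumOver-cong (λ x → #below-swap x a B b C) A

  swap-pointwise : ∀ a b y → b < a →
    iverson (y <? b) + iverson (a <? y) + 2 * (iverson (b <? y) * iverson (y <? a))
      ≤ iverson (y <? a) + iverson (b <? y)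
  swap-pointwise a b y b<a with y <? b | a <? y | b <? y | y <? a
  ... | yes p | _     | yes q | _     = ⊥-elim (<-asym p q)
  ... | yes p | yes q | no _  | _     = ⊥-elim (<-asym (<-trans p b<a) q)
  ... | yes p | no _  | no _  | yes _ = s≤s z≤n
  ... | yes p | no _  | no _  | no r  = ⊥-elim (r (<-trans p b<a))
  ... | no _  | yes q | yes _ | yes r = ⊥-elim (<-asym q r)
  ... | no _  | yes q | yes _ | no _  = s≤s z≤n
  ... | no p  | yes q | no r  | _     = ⊥-elim (r (<-trans b<a q))
  ... | no _  | no _  | yes _ | yes _ = ≤-refl
  ... | no _  | no _  | yes _ | no _  = z≤n
  ... | no _  | no _  | no _  | _     = z≤n

  #below-#above-swap : ∀ a b B → b < a →
    #below b B + #above a B + 2 * #between b a B ≤ #below a B + #above b B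
  #below-#above-swap a b B b<a =
    subst₂ _≤_ lhs (sumOver-+ _ _ B) (sumOver-mono (λ y → swap-pointwise a b y b<a) B)
    where
    lhs : sumOver (λ y → iverson (y <? b) + iverson (a <? y) + 2 * (iverson (b <? y) * iverson (y <? a))) B
          ≡ #below b B + #above a B + 2 * #between b a B
    lhs = trans (sumOver-+ _ _ B) (cong₂ _+_ (sumOver-+ _ _ B) (sumOver-2* _ B))

  inversions-split : ∀ a B b C → inversions (a ∷ B ++ b ∷ C) ≡
    #below a B + (iverson (b <? a) + #below a C)
      + (inversions B + (#above b B + crossInversions B C) + (#below b C + inversions C))
  inversions-split a B b C rewrite #below-++ a B (b ∷ C) | inversions-++ B (b ∷ C)
    | crossInversions-++ʳ B [ b ] C | crossInversions-[ b ] B = refl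

  inversions-swap-head : ∀ a b B C → b < a →
    inversions (b ∷ B ++ a ∷ C) + suc (2 * #between b a B) ≤ inversions (a ∷ B ++ b ∷ C)
  inversions-swap-head a b B C b<a
    rewrite inversions-split a B b C | inversions-split b B a C
          | iverson-yes (b <? a) b<a | iverson-no (a <? b) (<-asym b<a) =
    subst₂ _≤_ (sym lhs) (sym rhs) (+-monoˡ-≤ (suc rest) (#below-#above-swap a b B b<a))
    where
    rest = #below b C + crossInversions B C + #below a C + inversions C + inversions B
    rhs : #below a B + (1 + #below a C)
            + (inversions B + (#above b B + crossInversions B C) + (#below b C + inversions C))
          ≡ #below a B + #above b B + suc rest
    rhs = regroup (#below a B) (#below a C) (inversions B) (#above b B) (crossInversions B C)
            (#below b C) (inversions C)
      where
      regroup : ∀ s ac ib t cr bc ic →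
        s + (1 + ac) + (ib + (t + cr) + (bc + ic)) ≡ s + t + suc (bc + cr + ac + ic + ib)
      regroup = solve-∀
    lhs : #below b B + (0 + #below b C)
            + (inversions B + (#above a B + crossInversions B C) + (#below a C + inversions C))
            + suc (2 * #between b a B)
          ≡ #below b B + #above a B + 2 * #between b a B + suc rest
    lhs = regroup (#below b B) (#below b C) (inversions B) (#above a B) (crossInversions B C)
            (#below a C) (inversions C) (#between b a B)
      where
      regroup : ∀ p bc ib q cr ac ic w →
        p + (0 + bc) + (ib + (q + cr) + (ac + ic)) + suc (2 * w) ≡ p + q + 2 * w + suc (bc + cr + ac + ic + ib)
      regroup = solve-∀

  inversions-swap : ∀ A a b B C → b < a →
    inversions (A ++ b ∷ B ++ a ∷ C) + suc (2 * #between b a B) ≤ inversions (A ++ a ∷ B ++ b ∷ C)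
  inversions-swap A a b B C b<a = begin
    inversions (A ++ b ∷ B ++ a ∷ C) + extra
      ≡⟨ cong (_+ extra) (inversions-++ A (b ∷ B ++ a ∷ C)) ⟩
    prefix + inversions (b ∷ B ++ a ∷ C) + extra
      ≡⟨ +-assoc prefix _ extra ⟩
    prefix + (inversions (b ∷ B ++ a ∷ C) + extra)
      ≤⟨ +-monoʳ-≤ prefix (inversions-swap-head a b B C b<a) ⟩
    prefix + inversions (a ∷ B ++ b ∷ C)
      ≡⟨ cong (λ c → inversions A + c + inversions (a ∷ B ++ b ∷ C)) (crossInversions-swap A b B a C) ⟩
    inversions A + crossInversions A (a ∷ B ++ b ∷ C) + inversions (a ∷ B ++ b ∷ C)
      ≡⟨ inversions-++ A (a ∷ B ++ b ∷ C) ⟨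
    inversions (A ++ a ∷ B ++ b ∷ C) ∎
    where
    open ≤-Reasoning
    extra = suc (2 * #between b a B)
    prefix = inversions A + crossInversions A (b ∷ B ++ a ∷ C)

  inversions-adjacent-swap : ∀ A a b C → b < a →
    suc (inversions (A ++ b ∷ a ∷ C)) ≡ inversions (A ++ a ∷ b ∷ C)
  inversions-adjacent-swap A a b C b<a = ≤-antisym
    (subst (_≤ inversions (A ++ a ∷ b ∷ C)) (+-comm _ 1) (inversions-swap A a b [] C b<a))
    (≤-reflexive upper)
    where
    upper : inversions (A ++ a ∷ b ∷ C) ≡ suc (inversions (A ++ b ∷ a ∷ C))
    upper rewrite inversions-++ A (b ∷ a ∷ C) | inversions-++ A (a ∷ b ∷ C)
                | crossInversions-swap A a [] b C
                | iverson-yes (b <? a) b<a | iverson-no (a <? b) (<-asym b<a) =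
      regroup (inversions A + crossInversions A (b ∷ a ∷ C)) (#below a C) (#below b C) (inversions C)
      where
      regroup : ∀ z ac bc ic → z + (1 + ac + (bc + ic)) ≡ suc (z + (bc + (ac + ic)))
      regroup = solve-∀

  inversions-adjacent-swap-≤ : ∀ A a b C →
    inversions (A ++ a ∷ b ∷ C) ≤ suc (inversions (A ++ b ∷ a ∷ C))
  inversions-adjacent-swap-≤ A a b C with <-cmp a b
  ... | tri< a<b _ _ = ≤-trans (n≤1+n _) (≤-trans (≤-reflexive (inversions-adjacent-swap A b a C a<b)) (n≤1+n _))
  ... | tri≈ _ refl _ = n≤1+n _
  ... | tri> _ _ b<a = ≤-reflexive (sym (inversions-adjacent-swap A a b C b<a))

  #between-∈ : ∀ {lo hi x} B → lo < x → x < hi → x ∈ B → 1 ≤ #between lo hi B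
  #between-∈ {lo} {hi} (y ∷ B) p q (here refl)
    rewrite iverson-yes (lo <? y) p | iverson-yes (y <? hi) q = s≤s z≤n
  #between-∈ (y ∷ B) p q (there x∈B) = ≤-trans (#between-∈ B p q x∈B) (m≤n+m _ _)

module Transpositions where

  transpose : ℕ → ℕ → ℕ → ℕ
  transpose i j k with k ≟ i
  ... | yes _ = j
  ... | no _ with k ≟ j
  ...   | yes _ = i
  ...   | no _ = k

  transpose-left : ∀ i j → transpose i j i ≡ j
  transpose-left i j with i ≟ i
  ... | yes _ = refl
  ... | no i≢i = ⊥-elim (i≢i refl)

  transpose-right : ∀ i j → transpose i j j ≡ i
  transpose-right i j with j ≟ i
  ... | yes refl = refl
  ... | no _ with j ≟ j
  ...   | yes _ = refl
  ...   | no j≢j = ⊥-elim (j≢j refl)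

  transpose-other : ∀ {i j k} → k ≢ i → k ≢ j → transpose i j k ≡ k
  transpose-other {i} {j} {k} k≢i k≢j with k ≟ i
  ... | yes k≡i = ⊥-elim (k≢i k≡i)
  ... | no _ with k ≟ j
  ...   | yes k≡j = ⊥-elim (k≢j k≡j)
  ...   | no _ = refl

  transpose-involutive : ∀ i j k → transpose i j (transpose i j k) ≡ k
  transpose-involutive i j k with k ≟ i
  ... | yes refl = transpose-right k j
  ... | no k≢i with k ≟ j
  ...   | yes refl = transpose-left i k
  ...   | no k≢j = transpose-other k≢i k≢j

  transpose-sym : ∀ i j k → transpose i j k ≡ transpose j i k
  transpose-sym i j k = by-cases (k ≟ i) (k ≟ j)
    where
    by-cases : Dec (k ≡ i) → Dec (k ≡ j) → transpose i j k ≡ transpose j i k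
    by-cases (yes refl) _ = trans (transpose-left k j) (sym (transpose-right j k))
    by-cases (no _) (yes refl) = trans (transpose-right i k) (sym (transpose-left k i))
    by-cases (no k≢i) (no k≢j) = trans (transpose-other k≢i k≢j) (sym (transpose-other k≢j k≢i))

  transpose-< : ∀ {i j k N} → i < N → j < N → k < N → transpose i j k < N
  transpose-< {i} {j} {k} i<N j<N k<N with k ≟ i
  ... | yes _ = j<N
  ... | no _ with k ≟ j
  ...   | yes _ = i<N
  ...   | no _ = k<N

  transpose-disjoint-comm : ∀ {a b c d} → a ≢ c → a ≢ d → b ≢ c → b ≢ d →
    ∀ k → transpose a b (transpose c d k) ≡ transpose c d (transpose a b k)
  transpose-disjoint-comm {a} {b} {c} {d} a≢c a≢d b≢c b≢d k = by-cases (k ≟ a) (k ≟ b) (k ≟ c) (k ≟ d)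
    where
    open ≡-Reasoning
    by-cases : Dec (k ≡ a) → Dec (k ≡ b) → Dec (k ≡ c) → Dec (k ≡ d) →
      transpose a b (transpose c d k) ≡ transpose c d (transpose a b k)
    by-cases (yes refl) _ _ _ = begin
      transpose k b (transpose c d k) ≡⟨ cong (transpose k b) (transpose-other a≢c a≢d) ⟩
      transpose k b k                 ≡⟨ transpose-left k b ⟩
      b                               ≡⟨ transpose-other b≢c b≢d ⟨
      transpose c d b                 ≡⟨ cong (transpose c d) (transpose-left k b) ⟨
      transpose c d (transpose k b k) ∎
    by-cases (no _) (yes refl) _ _ = begin
      transpose a k (transpose c d k) ≡⟨ cong (transpose a k) (transpose-other b≢c b≢d) ⟩
      transpose a k k                 ≡⟨ transpose-right a k ⟩
      a                               ≡⟨ transpose-other a≢c a≢d ⟨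
      transpose c d a                 ≡⟨ cong (transpose c d) (transpose-right a k) ⟨
      transpose c d (transpose a k k) ∎
    by-cases (no k≢a) (no k≢b) (yes refl) _ = begin
      transpose a b (transpose k d k) ≡⟨ cong (transpose a b) (transpose-left k d) ⟩
      transpose a b d                 ≡⟨ transpose-other (a≢d ∘ sym) (b≢d ∘ sym) ⟩
      d                               ≡⟨ transpose-left k d ⟨
      transpose k d k                 ≡⟨ cong (transpose k d) (transpose-other k≢a k≢b) ⟨
      transpose k d (transpose a b k) ∎
    by-cases (no k≢a) (no k≢b) (no _) (yes refl) = begin
      transpose a b (transpose c k k) ≡⟨ cong (transpose a b) (transpose-right c k) ⟩
      transpose a b c                 ≡⟨ transpose-other (a≢c ∘ sym) (b≢c ∘ sym) ⟩
      c                               ≡⟨ transpose-right c k ⟨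
      transpose c k k                 ≡⟨ cong (transpose c k) (transpose-other k≢a k≢b) ⟨
      transpose c k (transpose a b k) ∎
    by-cases (no k≢a) (no k≢b) (no k≢c) (no k≢d) = begin
      transpose a b (transpose c d k) ≡⟨ cong (transpose a b) (transpose-other k≢c k≢d) ⟩
      transpose a b k                 ≡⟨ transpose-other k≢a k≢b ⟩
      k                               ≡⟨ transpose-other k≢c k≢d ⟨
      transpose c d k                 ≡⟨ cong (transpose c d) (transpose-other k≢a k≢b) ⟨
      transpose c d (transpose a b k) ∎

module Ranges where

  open Transpositions

  range : ℕ → ℕ → List ℕ
  range a zero = []
  range a (suc L) = a ∷ range (suc a) L

  range-++ : ∀ a p q → range a (p + q) ≡ range a p ++ range (a + p) q
  range-++ a zero q rewrite +-identityʳ a = refl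
  range-++ a (suc p) q rewrite range-++ (suc a) p q | +-suc a p = refl

  map-cong-range : ∀ {f g : ℕ → ℕ} a L → (∀ x → a ≤ x → x < a + L → f x ≡ g x) →
    map f (range a L) ≡ map g (range a L)
  map-cong-range a zero e = refl
  map-cong-range {f} {g} a (suc L) e = cong₂ _∷_
    (e a ≤-refl (subst (a <_) (sym (+-suc a L)) (m≤m+n (suc a) L)))
    (map-cong-range (suc a) L (λ x a<x x<aL → e x (<⇒≤ a<x) (subst (x <_) (sym (+-suc a L)) x<aL)))

  ∈-range : ∀ {a L x} → a ≤ x → x < a + L → x ∈ range a L
  ∈-range {a} {zero} a≤x x<a+0 = ⊥-elim (<⇒≱ (subst (_ <_) (+-identityʳ a) x<a+0) a≤x)
  ∈-range {a} {suc L} {x} a≤x x<aL with a ≟ x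
  ... | yes refl = here refl
  ... | no a≢x = there (∈-range (≤∧≢⇒< a≤x a≢x) (subst (x <_) (+-suc a L) x<aL))

  record SwapSplit (f : ℕ → ℕ) (a L i j : ℕ) : Set where
    field
      before between after : List ℕ
      split : map f (range a L) ≡ before ++ f i ∷ between ++ f j ∷ after
      split-swapped : map (f ∘ transpose i j) (range a L) ≡ before ++ f j ∷ between ++ f i ∷ after
      ∈-between : ∀ z → i < z → z < j → f z ∈ between
      between-adjacent : j ≡ suc i → between ≡ []

  swapSplit : ∀ f {a L i j} → a ≤ i → i < j → j < a + L → SwapSplit f a L i j
  swapSplit f {a} {L} a≤i i<j j<a+L
    with m≤n⇒∃[o]m+o≡n a≤i | m≤n⇒∃[o]m+o≡n i<j | m≤n⇒∃[o]m+o≡n j<a+L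
  ... | p , refl | q , refl | r , a+L≡
    with +-cancelˡ-≡ a L (p + suc (q + suc r)) (trans (sym a+L≡) (regroup a p q r))
    where
    regroup : ∀ a p q r → suc (suc (a + p) + q) + r ≡ a + (p + suc (q + suc r))
    regroup = solve-∀
  ... | refl = record
    { before = map f (range a p)
    ; between = map f (range (suc i) q)
    ; after = map f (range (suc j) r)
    ; split = image f
    ; split-swapped = trans (image (f ∘ transpose i j)) (cong₂ _++_ outside-fixed-before
        (cong₂ _∷_ (cong f (transpose-left i j)) (cong₂ _++_ outside-fixed-between
          (cong₂ _∷_ (cong f (transpose-right i j)) outside-fixed-after))))
    ; ∈-between = λ z i<z z<j → ∈-map⁺ f (∈-range i<z z<j)
    ; between-adjacent = λ j≡1+i → cong (map f ∘ range (suc i))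
        (+-cancelˡ-≡ i q 0 (trans (suc-injective j≡1+i) (sym (+-identityʳ i))))
    }
    where
    i = a + p
    j = suc i + q
    positions : range a (p + suc (q + suc r)) ≡ range a p ++ i ∷ range (suc i) q ++ j ∷ range (suc j) r
    positions rewrite range-++ a p (suc (q + suc r)) | range-++ (suc i) q (suc r) = refl
    image : ∀ g → map g (range a (p + suc (q + suc r)))
                  ≡ map g (range a p) ++ g i ∷ map g (range (suc i) q) ++ g j ∷ map g (range (suc j) r)
    image g rewrite positions | map-++ g (range a p) (i ∷ range (suc i) q ++ j ∷ range (suc j) r)
      | map-++ g (range (suc i) q) (j ∷ range (suc j) r) = refl
    outside-fixed-before : map (f ∘ transpose i j) (range a p) ≡ map f (range a p)
    outside-fixed-before = map-cong-range a p
      (λ x _ x<i → cong f (transpose-other (<⇒≢ x<i) (<⇒≢ (<-trans x<i i<j))))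
    outside-fixed-between : map (f ∘ transpose i j) (range (suc i) q) ≡ map f (range (suc i) q)
    outside-fixed-between = map-cong-range (suc i) q
      (λ x i<x x<j → cong f (transpose-other (>⇒≢ i<x) (<⇒≢ x<j)))
    outside-fixed-after : map (f ∘ transpose i j) (range (suc j) r) ≡ map f (range (suc j) r)
    outside-fixed-after = map-cong-range (suc j) r
      (λ x j<x _ → cong f (transpose-other (>⇒≢ (<-trans i<j j<x)) (>⇒≢ j<x)))

module Keys (m : ℕ) where

  open Transpositions

  n N : ℕ
  n = suc m
  N = n + n

  -- Keys 0, …, N - 1 enumerate -n < … < -1 < 1 < … < n in increasing order.
  key : SE n → ℕ
  key (false , i) = m ∸ toℕ i
  key (true , i) = n + toℕ i

  -- Negation on keys: mirror k = N - 1 - k.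
  mirror : ℕ → ℕ
  mirror k = (n + m) ∸ k

  N≡1+n+m : N ≡ suc (n + m)
  N≡1+n+m = +-suc n m

  <N⇒≤n+m : ∀ {k} → k < N → k ≤ n + m
  <N⇒≤n+m {k} k<N = s≤s⁻¹ (subst (k <_) N≡1+n+m k<N)

  ≤n+m⇒<N : ∀ {k} → k ≤ n + m → k < N
  ≤n+m⇒<N {k} k≤n+m = subst (k <_) (sym N≡1+n+m) (s≤s k≤n+m)

  n+<N : ∀ {k} → k ≤ m → n + k < N
  n+<N k≤m = +-monoʳ-< n (s≤s k≤m)

  n<N : n < N
  n<N = subst (_< N) (+-identityʳ n) (n+<N z≤n)

  m<N : m < N
  m<N = <-trans (n<1+n m) n<N

  key<N : ∀ x → key x < N
  key<N (false , i) = ≤n+m⇒<N (≤-trans (m∸n≤m m (toℕ i)) (m≤n+m m n))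
  key<N (true , i) = +-monoʳ-< n (toℕ<n i)

  n≤key-positive : ∀ i → n ≤ key (true , i)
  n≤key-positive i = m≤m+n n (toℕ i)

  key-negative<n : ∀ i → key (false , i) < n
  key-negative<n i = s≤s (m∸n≤m m (toℕ i))

  mirror-< : ∀ {k} → k < N → mirror k < N
  mirror-< {k} _ = ≤n+m⇒<N (m∸n≤m (n + m) k)

  mirror-involutive : ∀ {k} → k < N → mirror (mirror k) ≡ k
  mirror-involutive k<N = m∸[m∸n]≡n (<N⇒≤n+m k<N)

  mirror-reverses : ∀ {i j} → i < j → j < N → mirror j < mirror i
  mirror-reverses i<j j<N = ∸-monoʳ-< i<j (<N⇒≤n+m j<N)

  n≤mirror : ∀ {k} → k < n → n ≤ mirror k
  n≤mirror {k} k<n = subst (n ≤_) (sym (+-∸-assoc n (s≤s⁻¹ k<n))) (m≤m+n n (m ∸ k))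

  mirror<n : ∀ {k} → n ≤ k → mirror k < n
  mirror<n {k} n≤k with m≤n⇒∃[o]m+o≡n n≤k
  ... | c , refl = subst (_< n) (sym ([m+n]∸[m+o]≡n∸o n m c)) (s≤s (m∸n≤m m c))

  mirror-m : mirror m ≡ n
  mirror-m = m+n∸n≡m n m

  mirror-n : mirror n ≡ m
  mirror-n = m+n∸m≡n n m

  key-neg : ∀ x → key (neg x) ≡ mirror (key x)
  key-neg (false , i) = sym (trans (+-∸-assoc n (m∸n≤m m (toℕ i))) (cong (n +_) (m∸[m∸n]≡n (s≤s⁻¹ (toℕ<n i)))))
  key-neg (true , i) = sym ([m+n]∸[m+o]≡n∸o n m (toℕ i))

  unkey : ℕ → SE n
  unkey k with k <? n
  ... | yes _ = (false , fromℕ< {m ∸ k} (s≤s (m∸n≤m m k)))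
  ... | no _ with (k ∸ n) <? n
  ...   | yes k∸n<n = (true , fromℕ< k∸n<n)
  ...   | no _ = (true , fzero)

  unkey-key : ∀ x → unkey (key x) ≡ x
  unkey-key (false , i) with (m ∸ toℕ i) <? n
  ... | yes _ = cong (false ,_) (toℕ-injective (trans (toℕ-fromℕ< _) (m∸[m∸n]≡n (s≤s⁻¹ (toℕ<n i)))))
  ... | no ≮n = ⊥-elim (≮n (key-negative<n i))
  unkey-key (true , i) with (n + toℕ i) <? n
  ... | yes <n = ⊥-elim (<⇒≱ <n (n≤key-positive i))
  ... | no _ with (n + toℕ i ∸ n) <? n
  ...   | yes _ = cong (true ,_) (toℕ-injective (trans (toℕ-fromℕ< _) (m+n∸m≡n n (toℕ i))))
  ...   | no ≮n = ⊥-elim (≮n (subst (_< n) (sym (m+n∸m≡n n (toℕ i))) (toℕ<n i)))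

  key-unkey : ∀ {k} → k < N → key (unkey k) ≡ k
  key-unkey {k} k<N with k <? n
  ... | yes k<n = trans (cong (m ∸_) (toℕ-fromℕ< (s≤s (m∸n≤m m k)))) (m∸[m∸n]≡n (s≤s⁻¹ k<n))
  ... | no k≮n with (k ∸ n) <? n
  ...   | yes k∸n<n = trans (cong (n +_) (toℕ-fromℕ< k∸n<n)) (m+[n∸m]≡n (≮⇒≥ k≮n))
  ...   | no k∸n≮n = ⊥-elim (k∸n≮n (+-cancelˡ-< n _ _ (subst (_< N) (sym (m+[n∸m]≡n (≮⇒≥ k≮n))) k<N)))

  key-injective : ∀ {x y} → key x ≡ key y → x ≡ y
  key-injective {x} {y} e = trans (sym (unkey-key x)) (trans (cong unkey e) (unkey-key y))

  unkey-mirror : ∀ {k} → k < N → unkey (mirror k) ≡ neg (unkey k)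
  unkey-mirror {k} k<N =
    key-injective (trans (key-unkey (mirror-< k<N)) (sym (trans (key-neg (unkey k)) (cong mirror (key-unkey k<N)))))

  neg-≢ : ∀ (z : SE n) → neg z ≢ z
  neg-≢ (true , i) ()
  neg-≢ (false , i) ()

  mirror-≢ : ∀ {k} → k < N → mirror k ≢ k
  mirror-≢ {k} k<N e = neg-≢ (unkey k) (trans (sym (unkey-mirror k<N)) (cong unkey e))

  key-t : ∀ x y z → key (t x y z) ≡ transpose (key x) (key y) (key z)
  key-t x y z with z ≟SE x | key z ≟ key x
  ... | yes refl | yes _ = refl
  ... | yes refl | no k≢k = ⊥-elim (k≢k refl)
  ... | no z≢x | yes e = ⊥-elim (z≢x (key-injective e))
  ... | no _ | no _ with z ≟SE y | key z ≟ key y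
  ...   | yes refl | yes _ = refl
  ...   | yes refl | no k≢k = ⊥-elim (k≢k refl)
  ...   | no z≢y | yes e = ⊥-elim (z≢y (key-injective e))
  ...   | no _ | no _ = refl

  transpose-mirror : ∀ {a b k} → a < N → b < N → k < N →
    transpose a b (mirror k) ≡ mirror (transpose (mirror a) (mirror b) k)
  transpose-mirror {a} {b} {k} a<N b<N k<N = by-cases (mirror k ≟ a) (mirror k ≟ b)
    where
    mirror-flip : ∀ {c} → c < N → mirror k ≡ c → k ≡ mirror c
    mirror-flip c<N e = trans (sym (mirror-involutive k<N)) (cong mirror e)
    by-cases : Dec (mirror k ≡ a) → Dec (mirror k ≡ b) →
      transpose a b (mirror k) ≡ mirror (transpose (mirror a) (mirror b) k)
    by-cases (yes e) _ rewrite e | mirror-flip a<N e =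
      trans (transpose-left a b) (sym (trans (cong mirror (transpose-left (mirror a) (mirror b))) (mirror-involutive b<N)))
    by-cases (no _) (yes e) rewrite e | mirror-flip b<N e =
      trans (transpose-right a b) (sym (trans (cong mirror (transpose-right (mirror a) (mirror b))) (mirror-involutive a<N)))
    by-cases (no ≢a) (no ≢b) = trans (transpose-other ≢a ≢b) (cong mirror (sym (transpose-other {mirror a} {mirror b} {k}
      (λ e → ≢a (trans (cong mirror e) (mirror-involutive a<N)))
      (λ e → ≢b (trans (cong mirror e) (mirror-involutive b<N))))))

  Odd Bounded Injective<N : (ℕ → ℕ) → Set
  Odd h = ∀ k → k < N → h (mirror k) ≡ mirror (h k)
  Bounded h = ∀ k → k < N → h k < N
  Injective<N h = ∀ a b → a < N → b < N → h a ≡ h b → a ≡ b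

  onKeys : (SE n → SE n) → ℕ → ℕ
  onKeys g k = key (g (unkey k))

  onKeys-∘ : ∀ g {σ : SE n → SE n} {ρ : ℕ → ℕ} → (∀ z → key (σ z) ≡ ρ (key z)) → Bounded ρ →
    ∀ k → k < N → onKeys (g ∘ σ) k ≡ onKeys g (ρ k)
  onKeys-∘ g {σ} {ρ} σ≈ρ ρ<N k k<N = cong (key ∘ g) (key-injective (begin
    key (σ (unkey k))   ≡⟨ σ≈ρ (unkey k) ⟩
    ρ (key (unkey k))   ≡⟨ cong ρ (key-unkey k<N) ⟩
    ρ k                 ≡⟨ key-unkey (ρ<N k k<N) ⟨
    key (unkey (ρ k))   ∎))
    where open ≡-Reasoning

  onKeys-odd : ∀ {g} → (∀ z → g (neg z) ≡ neg (g z)) → Odd (onKeys g)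
  onKeys-odd {g} g-odd k k<N =
    trans (cong (key ∘ g) (unkey-mirror k<N)) (trans (cong key (g-odd (unkey k))) (key-neg (g (unkey k))))

  onKeys-bounded : ∀ g → Bounded (onKeys g)
  onKeys-bounded g k _ = key<N (g (unkey k))

  onKeys-injective : ∀ {g} → (∀ a b → g a ≡ g b → a ≡ b) → Injective<N (onKeys g)
  onKeys-injective g-inj a b a<N b<N e =
    trans (sym (key-unkey a<N)) (trans (cong key (g-inj _ _ (key-injective e))) (key-unkey b<N))

module Length (m : ℕ) where

  open Inversions
  open Transpositions
  open Ranges
  open Keys m

  inversionsOn negativesOn doubleLength : (ℕ → ℕ) → ℕ
  inversionsOn h = inversions (map h (range 0 N))
  negativesOn h = #below n (map h (range n n))
  doubleLength h = inversionsOn h + negativesOn h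

  doubleLength-cong : ∀ {h h'} → (∀ k → k < N → h k ≡ h' k) → doubleLength h ≡ doubleLength h'
  doubleLength-cong e = cong₂ _+_
    (cong inversions (map-cong-range 0 N (λ k _ → e k)))
    (cong (#below n) (map-cong-range n n (λ k _ → e k)))

  adjacentSplit : ∀ h i → suc i < N → ∃ λ A → ∃ λ C →
    map h (range 0 N) ≡ A ++ h i ∷ h (suc i) ∷ C
      × map (h ∘ transpose i (suc i)) (range 0 N) ≡ A ++ h (suc i) ∷ h i ∷ C
  adjacentSplit h i 1+i<N = before , after
    , subst (λ B → map h (range 0 N) ≡ before ++ h i ∷ B ++ h (suc i) ∷ after) (between-adjacent refl) split
    , subst (λ B → map (h ∘ transpose i (suc i)) (range 0 N) ≡ before ++ h (suc i) ∷ B ++ h i ∷ after)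
        (between-adjacent refl) split-swapped
    where open SwapSplit (swapSplit h z≤n (n<1+n i) 1+i<N)

  inversionsOn-adjacent-≤ : ∀ h i → suc i < N → inversionsOn (h ∘ transpose i (suc i)) ≤ suc (inversionsOn h)
  inversionsOn-adjacent-≤ h i 1+i<N with adjacentSplit h i 1+i<N
  ... | A , C , e , e' = subst₂ _≤_ (cong inversions (sym e')) (cong (suc ∘ inversions) (sym e))
    (inversions-adjacent-swap-≤ A (h (suc i)) (h i) C)

  inversionsOn-adjacent-descent : ∀ h i → suc i < N → h (suc i) < h i →
    suc (inversionsOn (h ∘ transpose i (suc i))) ≡ inversionsOn h
  inversionsOn-adjacent-descent h i 1+i<N d with adjacentSplit h i 1+i<N
  ... | A , C , e , e' = subst₂ _≡_ (cong (suc ∘ inversions) (sym e')) (cong inversions (sym e))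
    (inversions-adjacent-swap A (h i) (h (suc i)) C d)

  negativesOn-transpose-positive : ∀ h {i j} → n ≤ i → i < j → j < N →
    negativesOn (h ∘ transpose i j) ≡ negativesOn h
  negativesOn-transpose-positive h {i} {j} n≤i i<j j<N = begin
    #below n (map (h ∘ transpose i j) (range n n))  ≡⟨ cong (#below n) split-swapped ⟩
    #below n (before ++ h j ∷ between ++ h i ∷ after) ≡⟨ #below-++ n before _ ⟩
    #below n before + #below n (h j ∷ between ++ h i ∷ after)
      ≡⟨ cong (#below n before +_) (#below-swap n (h j) between (h i) after) ⟩
    #below n before + #below n (h i ∷ between ++ h j ∷ after) ≡⟨ #below-++ n before _ ⟨
    #below n (before ++ h i ∷ between ++ h j ∷ after) ≡⟨ cong (#below n) split ⟨
    #below n (map h (range n n)) ∎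
    where
    open ≡-Reasoning
    open SwapSplit (swapSplit h n≤i i<j j<N)

  negativesOn-transpose-negative : ∀ h {i j} → i < n → j < n → negativesOn (h ∘ transpose i j) ≡ negativesOn h
  negativesOn-transpose-negative h i<n j<n = cong (#below n) (map-cong-range n n (λ k n≤k _ →
    cong h (transpose-other (>⇒≢ (<-≤-trans i<n n≤k)) (>⇒≢ (<-≤-trans j<n n≤k)))))

  genKey : Fin n → ℕ → ℕ
  genKey fzero = transpose m n
  genKey (fsuc j) = transpose (n + toℕ j) (suc (n + toℕ j)) ∘ transpose (m ∸ suc (toℕ j)) (suc (m ∸ suc (toℕ j)))

  m∸j≡1+m∸1+j : ∀ {j} → j < m → m ∸ j ≡ suc (m ∸ suc j)
  m∸j≡1+m∸1+j j<m = +-∸-assoc 1 j<m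

  key-gen : ∀ s z → key (gen s z) ≡ genKey s (key z)
  key-gen fzero z = begin
    key (t (pos fzero) (neg (pos fzero)) z)       ≡⟨ key-t (pos fzero) (neg (pos fzero)) z ⟩
    transpose (n + 0) m (key z)                   ≡⟨ cong (λ a → transpose a m (key z)) (+-identityʳ n) ⟩
    transpose n m (key z)                         ≡⟨ transpose-sym n m (key z) ⟩
    transpose m n (key z)                         ∎
    where open ≡-Reasoning
  key-gen (fsuc j) z = begin
    key (t p q (t (neg p) (neg q) z))
      ≡⟨ key-t p q (t (neg p) (neg q) z) ⟩
    transpose (key p) (key q) (key (t (neg p) (neg q) z))
      ≡⟨ cong (transpose (key p) (key q)) (key-t (neg p) (neg q) z) ⟩
    transpose (key p) (key q) (transpose (key (neg p)) (key (neg q)) (key z))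
      ≡⟨ cong₂ (λ a b → transpose (n + a) b (transpose (m ∸ a) (m ∸ suc (toℕ j)) (key z)))
               (toℕ-inject₁ j) (+-suc n (toℕ j)) ⟩
    transpose (n + toℕ j) (suc (n + toℕ j)) (transpose (m ∸ toℕ j) (m ∸ suc (toℕ j)) (key z))
      ≡⟨ cong (transpose (n + toℕ j) (suc (n + toℕ j))) (trans
           (cong (λ a → transpose a (m ∸ suc (toℕ j)) (key z)) (m∸j≡1+m∸1+j (toℕ<n j)))
           (transpose-sym _ _ (key z))) ⟩
    genKey (fsuc j) (key z) ∎
    where
    open ≡-Reasoning
    p q : SE n
    p = pos (inject₁ j)
    q = pos (fsuc j)

  -- hi and lo are the keys of j + 1 and -(j + 2), the positions moved by s_(j+1).
  module GenPositions (j : Fin m) where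
    hi lo : ℕ
    hi = n + toℕ j
    lo = m ∸ suc (toℕ j)

    1+lo<n : suc lo < n
    1+lo<n = s≤s (subst (_≤ m) (m∸j≡1+m∸1+j (toℕ<n j)) (m∸n≤m m (toℕ j)))

    lo<n : lo < n
    lo<n = <-trans (n<1+n lo) 1+lo<n

    1+hi<N : suc hi < N
    1+hi<N = subst (_< N) (+-suc n (toℕ j)) (n+<N (toℕ<n j))

    hi<N : hi < N
    hi<N = <-trans (n<1+n hi) 1+hi<N

    n≤hi : n ≤ hi
    n≤hi = m≤m+n n (toℕ j)

    mirror-hi : mirror hi ≡ suc lo
    mirror-hi = trans ([m+n]∸[m+o]≡n∸o n m (toℕ j)) (m∸j≡1+m∸1+j (toℕ<n j))

    mirror-1+hi : mirror (suc hi) ≡ lo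
    mirror-1+hi = trans (cong mirror (sym (+-suc n (toℕ j)))) ([m+n]∸[m+o]≡n∸o n m (suc (toℕ j)))

    mirror-lo : mirror lo ≡ suc hi
    mirror-lo = trans (cong mirror (sym mirror-1+hi)) (mirror-involutive 1+hi<N)

    mirror-1+lo : mirror (suc lo) ≡ hi
    mirror-1+lo = trans (cong mirror (sym mirror-hi)) (mirror-involutive hi<N)

    negative≢positive : ∀ {a b} → a < n → n ≤ b → a ≢ b
    negative≢positive a<n n≤b = <⇒≢ (<-≤-trans a<n n≤b)

    transposes-comm : ∀ k →
      transpose hi (suc hi) (transpose lo (suc lo) k) ≡ transpose lo (suc lo) (transpose hi (suc hi) k)
    transposes-comm = transpose-disjoint-comm
      (≢-sym (negative≢positive lo<n n≤hi)) (≢-sym (negative≢positive 1+lo<n n≤hi))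
      (≢-sym (negative≢positive lo<n n≤1+hi)) (≢-sym (negative≢positive 1+lo<n n≤1+hi))
      where n≤1+hi = ≤-trans n≤hi (n≤1+n hi)

    negativesOn-genKey : ∀ h → negativesOn (h ∘ genKey (fsuc j)) ≡ negativesOn h
    negativesOn-genKey h = trans (negativesOn-transpose-negative (h ∘ transpose hi (suc hi)) lo<n 1+lo<n)
      (negativesOn-transpose-positive h n≤hi (n<1+n hi) 1+hi<N)

  negativesOn-s₀ : ∀ h → negativesOn (h ∘ genKey fzero) ≡ iverson (h m <? n) + #below n (map h (range (suc n) m))
  negativesOn-s₀ h = cong₂ _+_ (cong (λ z → iverson (h z <? n)) (transpose-right m n))
    (cong (#below n) (map-cong-range (suc n) m (λ k n<k _ →
      cong h (transpose-other (>⇒≢ (<-trans (n<1+n m) n<k)) (>⇒≢ n<k)))))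

  genKey-bounded : ∀ s → Bounded (genKey s)
  genKey-bounded fzero k = transpose-< m<N n<N
  genKey-bounded (fsuc j) k k<N = transpose-< hi<N 1+hi<N (transpose-< (<-trans lo<n n<N) (<-trans 1+lo<n n<N) k<N)
    where open GenPositions j

  genKey-involutive : ∀ s k → genKey s (genKey s k) ≡ k
  genKey-involutive fzero = transpose-involutive m n
  genKey-involutive (fsuc j) k = begin
    transpose hi (suc hi) (transpose lo (suc lo) (transpose hi (suc hi) (transpose lo (suc lo) k)))
      ≡⟨ cong (transpose hi (suc hi)) (transposes-comm (transpose lo (suc lo) k)) ⟨
    transpose hi (suc hi) (transpose hi (suc hi) (transpose lo (suc lo) (transpose lo (suc lo) k)))
      ≡⟨ transpose-involutive hi (suc hi) _ ⟩
    transpose lo (suc lo) (transpose lo (suc lo) k)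
      ≡⟨ transpose-involutive lo (suc lo) k ⟩
    k ∎
    where
    open GenPositions j
    open ≡-Reasoning

  genKey-odd : ∀ s → Odd (genKey s)
  genKey-odd fzero k k<N = begin
    transpose m n (mirror k)                   ≡⟨ transpose-mirror m<N n<N k<N ⟩
    mirror (transpose (mirror m) (mirror n) k) ≡⟨ cong₂ (λ a b → mirror (transpose a b k)) mirror-m mirror-n ⟩
    mirror (transpose n m k)                   ≡⟨ cong mirror (transpose-sym n m k) ⟩
    mirror (transpose m n k)                   ∎
    where open ≡-Reasoning
  genKey-odd (fsuc j) k k<N = begin
    transpose hi (suc hi) (transpose lo (suc lo) (mirror k))
      ≡⟨ cong (transpose hi (suc hi)) (transpose-mirror lo<N 1+lo<N k<N) ⟩
    transpose hi (suc hi) (mirror (transpose (mirror lo) (mirror (suc lo)) k))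
      ≡⟨ transpose-mirror hi<N 1+hi<N (transpose-< (mirror-< lo<N) (mirror-< 1+lo<N) k<N) ⟩
    mirror (transpose (mirror hi) (mirror (suc hi)) (transpose (mirror lo) (mirror (suc lo)) k))
      ≡⟨ cong mirror (cong₂ (λ a b → transpose a b (transpose (mirror lo) (mirror (suc lo)) k))
                            mirror-hi mirror-1+hi) ⟩
    mirror (transpose (suc lo) lo (transpose (mirror lo) (mirror (suc lo)) k))
      ≡⟨ cong mirror (cong (transpose (suc lo) lo) (cong₂ (λ a b → transpose a b k) mirror-lo mirror-1+lo)) ⟩
    mirror (transpose (suc lo) lo (transpose (suc hi) hi k))
      ≡⟨ cong mirror (trans (transpose-sym (suc lo) lo (transpose (suc hi) hi k))
                            (cong (transpose lo (suc lo)) (transpose-sym (suc hi) hi k))) ⟩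
    mirror (transpose lo (suc lo) (transpose hi (suc hi) k))
      ≡⟨ cong mirror (transposes-comm k) ⟨
    mirror (transpose hi (suc hi) (transpose lo (suc lo) k)) ∎
    where
    open GenPositions j
    open ≡-Reasoning
    lo<N = <-trans lo<n n<N
    1+lo<N = <-trans 1+lo<n n<N

  doubleLength-genKey-≤ : ∀ h s → doubleLength (h ∘ genKey s) ≤ 2 + doubleLength h
  doubleLength-genKey-≤ h fzero = begin
    inversionsOn (h ∘ transpose m n) + negativesOn (h ∘ transpose m n)
      ≡⟨ cong (inversionsOn (h ∘ transpose m n) +_) (negativesOn-s₀ h) ⟩
    inversionsOn (h ∘ transpose m n) + (iverson (h m <? n) + rest)
      ≤⟨ +-mono-≤ (inversionsOn-adjacent-≤ h m n<N) (+-monoˡ-≤ rest (iverson≤1 (h m <? n))) ⟩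
    suc (inversionsOn h) + (1 + rest)
      ≡⟨ regroup (inversionsOn h) rest ⟩
    2 + (inversionsOn h + rest)
      ≤⟨ +-monoʳ-≤ 2 (+-monoʳ-≤ (inversionsOn h) (m≤n+m rest (iverson (h n <? n)))) ⟩
    2 + doubleLength h ∎
    where
    open ≤-Reasoning
    rest = #below n (map h (range (suc n) m))
    regroup : ∀ a c → suc a + (1 + c) ≡ 2 + (a + c)
    regroup = solve-∀
  doubleLength-genKey-≤ h (fsuc j) = begin
    inversionsOn (h₁ ∘ transpose lo (suc lo)) + negativesOn (h ∘ genKey (fsuc j))
      ≡⟨ cong (inversionsOn (h₁ ∘ transpose lo (suc lo)) +_) (negativesOn-genKey h) ⟩
    inversionsOn (h₁ ∘ transpose lo (suc lo)) + negativesOn h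
      ≤⟨ +-monoˡ-≤ (negativesOn h) (≤-trans (inversionsOn-adjacent-≤ h₁ lo (<-trans 1+lo<n n<N))
                                              (s≤s (inversionsOn-adjacent-≤ h hi 1+hi<N))) ⟩
    2 + doubleLength h ∎
    where
    open GenPositions j
    open ≤-Reasoning
    h₁ = h ∘ transpose hi (suc hi)

  -- s is a right descent of the signed permutation whose key map is h.
  Descent : Fin n → (ℕ → ℕ) → Set
  Descent fzero h = h n < n
  Descent (fsuc j) h = h (suc (n + toℕ j)) < h (n + toℕ j)

  descent? : ∀ s h → Dec (Descent s h)
  descent? fzero h = h n <? n
  descent? (fsuc j) h = h (suc (n + toℕ j)) <? h (n + toℕ j)

  doubleLength-descent : ∀ {h} s → Odd h → Bounded h → Descent s h → 2 + doubleLength (h ∘ genKey s) ≡ doubleLength h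
  doubleLength-descent {h} fzero h-odd h<N d = begin
    2 + (inversionsOn (h ∘ transpose m n) + negativesOn (h ∘ transpose m n))
      ≡⟨ cong (λ c → 2 + (inversionsOn (h ∘ transpose m n) + c))
           (trans (negativesOn-s₀ h) (cong (_+ rest) (iverson-no (h m <? n) (≤⇒≯ n≤hm)))) ⟩
    2 + (inversionsOn (h ∘ transpose m n) + rest)
      ≡⟨ regroup (inversionsOn (h ∘ transpose m n)) rest ⟩
    suc (inversionsOn (h ∘ transpose m n)) + (1 + rest)
      ≡⟨ cong₂ _+_ (inversionsOn-adjacent-descent h m n<N (<-≤-trans d n≤hm))
                   (cong (_+ rest) (sym (iverson-yes (h n <? n) d))) ⟩
    doubleLength h ∎
    where
    open ≡-Reasoning
    rest = #below n (map h (range (suc n) m))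
    n≤hm : n ≤ h m
    n≤hm = subst (n ≤_) (trans (sym (h-odd n n<N)) (cong h mirror-n)) (n≤mirror d)
    regroup : ∀ a c → 2 + (a + c) ≡ suc a + (1 + c)
    regroup = solve-∀
  doubleLength-descent {h} (fsuc j) h-odd h<N d = begin
    2 + (inversionsOn (h₁ ∘ transpose lo (suc lo)) + negativesOn (h ∘ genKey (fsuc j)))
      ≡⟨ cong (λ c → 2 + (inversionsOn (h₁ ∘ transpose lo (suc lo)) + c)) (negativesOn-genKey h) ⟩
    2 + (inversionsOn (h₁ ∘ transpose lo (suc lo)) + negativesOn h)
      ≡⟨ cong (_+ negativesOn h) (trans (cong suc (inversionsOn-adjacent-descent h₁ lo (<-trans 1+lo<n n<N) d₁))
                                        (inversionsOn-adjacent-descent h hi 1+hi<N d)) ⟩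
    doubleLength h ∎
    where
    open GenPositions j
    open ≡-Reasoning
    h₁ = h ∘ transpose hi (suc hi)
    fixes-negative : ∀ {k} → k < n → transpose hi (suc hi) k ≡ k
    fixes-negative k<n = transpose-other (negative≢positive k<n n≤hi) (negative≢positive k<n (≤-trans n≤hi (n≤1+n hi)))
    -- By oddness the descent at hi is mirrored to one at lo.
    d₁ : h₁ (suc lo) < h₁ lo
    d₁ = subst₂ _<_
      (trans (sym (h-odd hi hi<N)) (trans (cong h mirror-hi) (cong h (sym (fixes-negative 1+lo<n)))))
      (trans (sym (h-odd (suc hi) 1+hi<N)) (trans (cong h mirror-1+hi) (cong h (sym (fixes-negative lo<n)))))
      (mirror-reverses d (h<N hi hi<N))

  no-descent⇒fixes-positive : ∀ {h} → Bounded h → Injective<N h → (∀ s → ¬ Descent s h) →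
    ∀ {k} → n ≤ k → k < N → h k ≡ k
  no-descent⇒fixes-positive {h} h<N h-inj no-descent n≤k k<N with m≤n⇒∃[o]m+o≡n n≤k
  ... | i , refl = ≤-antisym (upper (m ∸ i) i (m∸n+n≡m i≤m)) (lower i i≤m)
    where
    i≤m = s≤s⁻¹ (+-cancelˡ-< n i n k<N)
    increasing : ∀ {i} → i < m → h (n + i) < h (n + suc i)
    increasing {i} i<m = ≤∧≢⇒< ascent
      (λ e → 1+n≰n (≤-reflexive (sym (trans (h-inj _ _ (n+<N (<⇒≤ i<m)) (n+<N i<m) e) (+-suc n i)))))
      where
      ascent : h (n + i) ≤ h (n + suc i)
      ascent = subst₂ (λ a b → h a ≤ h b) (cong (n +_) (toℕ-fromℕ< i<m))
        (trans (sym (+-suc n _)) (cong (λ c → n + suc c) (toℕ-fromℕ< i<m))) (≮⇒≥ (no-descent (fsuc (fromℕ< i<m))))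
    lower : ∀ i → i ≤ m → n + i ≤ h (n + i)
    lower zero _ = subst (λ c → c ≤ h c) (sym (+-identityʳ n)) (≮⇒≥ (no-descent fzero))
    lower (suc i) i<m = subst (_≤ h (n + suc i)) (sym (+-suc n i)) (<-≤-trans (s≤s (lower i (<⇒≤ i<m))) (increasing i<m))
    upper : ∀ d i → d + i ≡ m → h (n + i) ≤ n + i
    upper zero i refl = <N⇒≤n+m (h<N _ (n+<N ≤-refl))
    upper (suc d) i d+i≡m = ≤-pred (≤-trans (increasing i<m)
      (subst (h (n + suc i) ≤_) (+-suc n i) (upper d (suc i) (trans (+-suc d i) d+i≡m))))
      where
      i<m : i < m
      i<m = subst (i <_) d+i≡m (s≤s (m≤n+m i d))

  no-descent⇒identity : ∀ {h} → Odd h → Bounded h → Injective<N h → (∀ s → ¬ Descent s h) →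
    ∀ k → k < N → h k ≡ k
  no-descent⇒identity {h} h-odd h<N h-inj no-descent k k<N with n ≤? k
  ... | yes n≤k = no-descent⇒fixes-positive h<N h-inj no-descent n≤k k<N
  ... | no n≰k = begin
    h k                   ≡⟨ cong h (mirror-involutive k<N) ⟨
    h (mirror (mirror k)) ≡⟨ h-odd (mirror k) (mirror-< k<N) ⟩
    mirror (h (mirror k)) ≡⟨ cong mirror (no-descent⇒fixes-positive h<N h-inj no-descent
                                            (n≤mirror (≰⇒> n≰k)) (mirror-< k<N)) ⟩
    mirror (mirror k)     ≡⟨ mirror-involutive k<N ⟩
    k                     ∎
    where open ≡-Reasoning

  gen-involutive : ∀ s z → gen s (gen s z) ≡ z
  gen-involutive s z = key-injective (begin
    key (gen s (gen s z))     ≡⟨ key-gen s (gen s z) ⟩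
    genKey s (key (gen s z))  ≡⟨ cong (genKey s) (key-gen s z) ⟩
    genKey s (genKey s (key z)) ≡⟨ genKey-involutive s (key z) ⟩
    key z                     ∎)
    where open ≡-Reasoning

  gen-odd : ∀ s z → gen s (neg z) ≡ neg (gen s z)
  gen-odd s z = key-injective (begin
    key (gen s (neg z))       ≡⟨ key-gen s (neg z) ⟩
    genKey s (key (neg z))    ≡⟨ cong (genKey s) (key-neg z) ⟩
    genKey s (mirror (key z)) ≡⟨ genKey-odd s (key z) (key<N z) ⟩
    mirror (genKey s (key z)) ≡⟨ cong mirror (key-gen s z) ⟨
    mirror (key (gen s z))    ≡⟨ key-neg (gen s z) ⟨
    key (neg (gen s z))       ∎)
    where open ≡-Reasoning

  onKeys-gen : ∀ g s k → k < N → onKeys (g ∘ gen s) k ≡ onKeys g (genKey s k)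
  onKeys-gen g s = onKeys-∘ g {gen s} (key-gen s) (genKey-bounded s)

  #below-range : ∀ {x a} L → x ≤ a → #below x (range a L) ≡ 0
  #below-range zero x≤a = refl
  #below-range {x} {a} (suc L) x≤a
    rewrite iverson-no (a <? x) (≤⇒≯ x≤a) = #below-range L (≤-trans x≤a (n≤1+n a))

  inversions-range : ∀ a L → inversions (range a L) ≡ 0
  inversions-range a zero = refl
  inversions-range a (suc L) rewrite #below-range L (n≤1+n a) = inversions-range (suc a) L

  doubleLength-identity : ∀ {h} → (∀ k → k < N → h k ≡ k) → doubleLength h ≡ 0
  doubleLength-identity {h} h≈id = begin
    doubleLength h                                                         ≡⟨ doubleLength-cong h≈id ⟩
    inversions (map id (range 0 N)) + #below n (map id (range n n))
      ≡⟨ cong₂ (λ xs ys → inversions xs + #below n ys) (map-id (range 0 N)) (map-id (range n n)) ⟩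
    inversions (range 0 N) + #below n (range n n)
      ≡⟨ cong₂ _+_ (inversions-range 0 N) (#below-range n ≤-refl) ⟩
    0                                                                      ∎
    where open ≡-Reasoning

  doubleLength≤2*length : ∀ w {f g : SE n → SE n} → Represents w f → (∀ z → g (f z) ≡ z) →
    doubleLength (onKeys g) ≤ 2 * length w
  doubleLength≤2*length [] {g = g} w≈f gf≈id =
    ≤-reflexive (doubleLength-identity (λ k k<N → trans (cong key (trans (cong g (w≈f (unkey k))) (gf≈id (unkey k))))
                                                         (key-unkey k<N)))
  doubleLength≤2*length (s ∷ w) {g = g} w≈f gf≈id = begin
    doubleLength (onKeys g)
      ≡⟨ doubleLength-cong (λ k k<N → trans (cong (key ∘ g) (sym (gen-involutive s (unkey k))))
                                             (onKeys-gen (g ∘ gen s) s k k<N)) ⟩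
    doubleLength (onKeys (g ∘ gen s) ∘ genKey s)
      ≤⟨ doubleLength-genKey-≤ (onKeys (g ∘ gen s)) s ⟩
    2 + doubleLength (onKeys (g ∘ gen s))
      ≤⟨ +-monoʳ-≤ 2 (doubleLength≤2*length w {g = g ∘ gen s} (λ z → refl)
                                              (λ z → trans (cong g (w≈f z)) (gf≈id z))) ⟩
    2 + 2 * length w
      ≡⟨ *-distribˡ-+ 2 1 (length w) ⟨
    2 * length (s ∷ w) ∎
    where open ≤-Reasoning

  doubleLength-gen-descent : ∀ {g} s → (∀ z → g (neg z) ≡ neg (g z)) → Descent s (onKeys g) →
    2 + doubleLength (onKeys (g ∘ gen s)) ≡ doubleLength (onKeys g)
  doubleLength-gen-descent {g} s g-odd d = trans (cong (2 +_) (doubleLength-cong (onKeys-gen g s)))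
    (doubleLength-descent s (onKeys-odd g-odd) (onKeys-bounded g) d)

  -- Undoing descents one at a time sorts g, by a word of length doubleLength / 2.
  sortingWord : ∀ bound (g : SE n → SE n) → (∀ z → g (neg z) ≡ neg (g z)) → (∀ a b → g a ≡ g b → a ≡ b) →
    doubleLength (onKeys g) ≤ bound →
    Σ (List (Fin n)) λ w → 2 * length w ≤ doubleLength (onKeys g) × (∀ z → wordProd w (g z) ≡ z)
  sortingWord bound g g-odd g-inj ≤bound with any? (λ s → descent? s (onKeys g))
  ... | no no-descent = [] , z≤n , λ z → key-injective (trans (cong (key ∘ g) (sym (unkey-key z)))
          (no-descent⇒identity (onKeys-odd g-odd) (onKeys-bounded g) (onKeys-injective g-inj)
                               (λ s d → no-descent (s , d)) (key z) (key<N z)))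
  ... | yes (s , d) with bound
  ...   | zero =
    ⊥-elim (1+n≰n (≤-trans (≤-trans (m≤m+n 1 _) (≤-reflexive (doubleLength-gen-descent s g-odd d))) ≤bound))
  ...   | suc bound' with sortingWord bound' (g ∘ gen s) (λ z → trans (cong g (gen-odd s z)) (g-odd (gen s z)))
            (λ a b e → trans (sym (gen-involutive s a)) (trans (cong (gen s) (g-inj _ _ e)) (gen-involutive s b)))
            (≤-pred (≤-trans (≤-trans (n≤1+n _) (≤-reflexive (doubleLength-gen-descent s g-odd d))) ≤bound))
  ...     | w , 2|w|≤ , w∘g≈id = s ∷ w , 2|sw|≤ , λ z → begin
    gen s (wordProd w (g z))                  ≡⟨ cong (gen s ∘ wordProd w ∘ g) (gen-involutive s z) ⟨
    gen s (wordProd w (g (gen s (gen s z))))  ≡⟨ cong (gen s) (w∘g≈id (gen s z)) ⟩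
    gen s (gen s z)                           ≡⟨ gen-involutive s z ⟩
    z                                         ∎
    where
    open ≡-Reasoning
    2|sw|≤ : 2 * length (s ∷ w) ≤ doubleLength (onKeys g)
    2|sw|≤ = subst₂ _≤_ (sym (*-distribˡ-+ 2 1 (length w))) (doubleLength-gen-descent s g-odd d) (+-monoʳ-≤ 2 2|w|≤)

  doubleLength≡2*length : ∀ {f g : SE n → SE n} {L} → (∀ z → g (f z) ≡ z) → (∀ z → f (g z) ≡ z) →
    (∀ z → g (neg z) ≡ neg (g z)) → HasLength f L → doubleLength (onKeys g) ≡ 2 * L
  doubleLength≡2*length {f} {g} gf≈id fg≈id g-odd ((w , |w|≡L , w≈f) , minimal) with
    sortingWord _ g g-odd (λ a b e → trans (sym (fg≈id a)) (trans (cong f e) (fg≈id b))) ≤-refl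
  ... | w' , 2|w'|≤ , w'∘g≈id = ≤-antisym
    (subst (λ l → doubleLength (onKeys g) ≤ 2 * l) |w|≡L (doubleLength≤2*length w {g = g} w≈f gf≈id))
    (≤-trans (*-monoʳ-≤ 2 (minimal w' (λ z → trans (cong (wordProd w') (sym (gf≈id z))) (w'∘g≈id (f z)))))
             2|w'|≤)

module Covers (m : ℕ) where

  open Inversions
  open Transpositions
  open Ranges
  open Keys m
  open Length m

  inversionsOn-transpose-ascent : ∀ h {i j} → i < j → j < N → h i < h j →
    suc (inversionsOn h) ≤ inversionsOn (h ∘ transpose i j)
  inversionsOn-transpose-ascent h {i} {j} i<j j<N hi<hj = subst₂ _≤_
    (trans (+-comm _ 1) (cong (suc ∘ inversions) (sym split)))
    (cong inversions (sym split-swapped))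
    (≤-trans (+-monoʳ-≤ (inversions (before ++ h i ∷ between ++ h j ∷ after)) (s≤s z≤n))
             (inversions-swap before (h j) (h i) between after hi<hj))
    where open SwapSplit (swapSplit h z≤n i<j j<N)

  inversionsOn-transpose-descent : ∀ h {i j} → i < j → j < N → h j < h i →
    suc (inversionsOn (h ∘ transpose i j)) ≤ inversionsOn h
  inversionsOn-transpose-descent h {i} {j} i<j j<N hj<hi = subst₂ _≤_
    (trans (+-comm _ 1) (cong (suc ∘ inversions) (sym split-swapped)))
    (cong inversions (sym split))
    (≤-trans (+-monoʳ-≤ (inversions (before ++ h j ∷ between ++ h i ∷ after)) (s≤s z≤n))
             (inversions-swap before (h i) (h j) between after hj<hi))
    where open SwapSplit (swapSplit h z≤n i<j j<N)

  inversionsOn-transpose-descent-around : ∀ h {i j z} → i < j → j < N → h j < h i →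
    i < z → z < j → h j < h z → h z < h i →
    3 + inversionsOn (h ∘ transpose i j) ≤ inversionsOn h
  inversionsOn-transpose-descent-around h {i} {j} {z} i<j j<N hj<hi i<z z<j hj<hz hz<hi = subst₂ _≤_
    (trans (+-comm _ 3) (cong (λ l → 3 + inversions l) (sym split-swapped)))
    (cong inversions (sym split))
    (≤-trans (+-monoʳ-≤ (inversions (before ++ h j ∷ between ++ h i ∷ after))
                        (s≤s (*-monoʳ-≤ 2 (#between-∈ between hj<hz hz<hi (∈-between z i<z z<j)))))
             (inversions-swap before (h i) (h j) between after hj<hi))
    where open SwapSplit (swapSplit h z≤n i<j j<N)

  -- The condition for G ∘ transpose a b to be covered by G in the Bruhat order of permutations.
  Cover : (ℕ → ℕ) → ℕ → ℕ → Set
  Cover G a b = a < b → G b < G a × (∀ z → a < z → z < b → G b < G z → G z < G a → ⊥)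

  -- The key image of u_(x,y) for x ≢ -y.
  reflectionKey : ℕ → ℕ → ℕ → ℕ
  reflectionKey a b = transpose a b ∘ transpose (mirror a) (mirror b)

  reflectionKey-sym : ∀ a b k → reflectionKey b a k ≡ reflectionKey a b k
  reflectionKey-sym a b k =
    trans (transpose-sym b a (transpose (mirror b) (mirror a) k)) (cong (transpose a b) (transpose-sym (mirror b) (mirror a) k))

  module Reflection {a b} (a<N : a < N) (b<N : b < N) (a≢-b : a ≢ mirror b) where

    b≢-a : b ≢ mirror a
    b≢-a e = a≢-b (trans (sym (mirror-involutive a<N)) (cong mirror (sym e)))

    transposes-comm : ∀ k →
      transpose a b (transpose (mirror a) (mirror b) k) ≡ transpose (mirror a) (mirror b) (transpose a b k)
    transposes-comm = transpose-disjoint-comm (≢-sym (mirror-≢ a<N)) a≢-b b≢-a (≢-sym (mirror-≢ b<N))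

    reflectionKey-bounded : Bounded (reflectionKey a b)
    reflectionKey-bounded k k<N = transpose-< a<N b<N (transpose-< (mirror-< a<N) (mirror-< b<N) k<N)

    reflectionKey-involutive : ∀ k → reflectionKey a b (reflectionKey a b k) ≡ k
    reflectionKey-involutive k = begin
      transpose a b (transpose (mirror a) (mirror b) (transpose a b (transpose (mirror a) (mirror b) k)))
        ≡⟨ cong (transpose a b) (transposes-comm (transpose (mirror a) (mirror b) k)) ⟨
      transpose a b (transpose a b (transpose (mirror a) (mirror b) (transpose (mirror a) (mirror b) k)))
        ≡⟨ transpose-involutive a b _ ⟩
      transpose (mirror a) (mirror b) (transpose (mirror a) (mirror b) k)
        ≡⟨ transpose-involutive (mirror a) (mirror b) k ⟩
      k ∎
      where open ≡-Reasoning

    reflectionKey-odd : Odd (reflectionKey a b)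
    reflectionKey-odd k k<N = begin
      transpose a b (transpose (mirror a) (mirror b) (mirror k))
        ≡⟨ cong (transpose a b) (transpose-mirror (mirror-< a<N) (mirror-< b<N) k<N) ⟩
      transpose a b (mirror (transpose (mirror (mirror a)) (mirror (mirror b)) k))
        ≡⟨ cong (λ l → transpose a b (mirror l))
             (cong₂ (λ c d → transpose c d k) (mirror-involutive a<N) (mirror-involutive b<N)) ⟩
      transpose a b (mirror (transpose a b k))
        ≡⟨ transpose-mirror a<N b<N (transpose-< a<N b<N k<N) ⟩
      mirror (transpose (mirror a) (mirror b) (transpose a b k))
        ≡⟨ cong mirror (transposes-comm k) ⟨
      mirror (reflectionKey a b k) ∎
      where open ≡-Reasoning

  -- Two inversions are removed by the reflection, one per transposition, and each transposition
  -- removes at least one (resp. three, around an intermediate entry) or adds at least one.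
  reflection-drop⇒cover : ∀ {G a b} → Odd G → Bounded G → Injective<N G → b < N → a ≢ mirror b →
    2 + inversionsOn (G ∘ reflectionKey a b) ≡ inversionsOn G → Cover G a b
  reflection-drop⇒cover {G} {a} {b} G-odd G<N G-inj b<N a≢-b drop a<b = Gb<Ga , nothing-between
    where
    a<N = <-trans a<b b<N
    open Reflection a<N b<N a≢-b
    G₁ = G ∘ transpose a b
    G₂ = G₁ ∘ transpose (mirror b) (mirror a)
    drop₂ : 2 + inversionsOn G₂ ≡ inversionsOn G
    drop₂ = trans (cong (λ l → 2 + inversions l)
      (map-cong (λ k → cong G₁ (transpose-sym (mirror b) (mirror a) k)) (range 0 N))) drop
    -b<-a : mirror b < mirror a
    -b<-a = mirror-reverses a<b b<N
    G₁-b : G₁ (mirror b) ≡ mirror (G b)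
    G₁-b = trans (cong G (transpose-other (≢-sym a≢-b) (mirror-≢ b<N))) (G-odd b b<N)
    G₁-a : G₁ (mirror a) ≡ mirror (G a)
    G₁-a = trans (cong G (transpose-other (mirror-≢ a<N) (≢-sym b≢-a))) (G-odd a a<N)
    Gb<Ga : G b < G a
    Gb<Ga with <-cmp (G a) (G b)
    ... | tri> _ _ Gb<Ga = Gb<Ga
    ... | tri≈ _ e _ = ⊥-elim (<-irrefl (G-inj a b a<N b<N e) a<b)
    ... | tri< Ga<Gb _ _ = ⊥-elim (<⇒≱ (<-trans ascent₁ ascent₂) (subst (inversionsOn G₂ ≤_) drop₂ (m≤n+m _ 2)))
      where
      ascent₁ : suc (inversionsOn G) ≤ inversionsOn G₁
      ascent₁ = inversionsOn-transpose-ascent G a<b b<N Ga<Gb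
      ascent₂ : suc (inversionsOn G₁) ≤ inversionsOn G₂
      ascent₂ = inversionsOn-transpose-ascent G₁ -b<-a (mirror-< a<N)
        (subst₂ _<_ (sym G₁-b) (sym G₁-a) (mirror-reverses Ga<Gb (G<N b b<N)))
    nothing-between : ∀ z → a < z → z < b → G b < G z → G z < G a → ⊥
    nothing-between z a<z z<b Gb<Gz Gz<Ga = 1+n≰n (≤-trans (n≤1+n _) (≤-pred (≤-pred (begin
      4 + inversionsOn G₂      ≤⟨ +-monoʳ-≤ 3 descent₂ ⟩
      3 + inversionsOn G₁      ≤⟨ descent₁ ⟩
      inversionsOn G           ≡⟨ drop₂ ⟨
      2 + inversionsOn G₂      ∎))))
      where
      open ≤-Reasoning
      descent₁ : 3 + inversionsOn G₁ ≤ inversionsOn G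
      descent₁ = inversionsOn-transpose-descent-around G a<b b<N Gb<Ga a<z z<b Gb<Gz Gz<Ga
      descent₂ : suc (inversionsOn G₂) ≤ inversionsOn G₁
      descent₂ = inversionsOn-transpose-descent G₁ -b<-a (mirror-< a<N)
        (subst₂ _<_ (sym G₁-a) (sym G₁-b) (mirror-reverses Gb<Ga (G<N a a<N)))

  SameHalf : ℕ → ℕ → Set
  SameHalf x y = (x < n → y < n) × (y < n → x < n)

  SameHalf-sym : ∀ {x y} → SameHalf x y → SameHalf y x
  SameHalf-sym (x→y , y→x) = y→x , x→y

  SameHalf-iverson : ∀ {x y} → SameHalf x y → iverson (x <? n) ≡ iverson (y <? n)
  SameHalf-iverson {x} {y} (x→y , y→x) with x <? n | y <? n
  ... | yes _ | yes _ = refl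
  ... | no _ | no _ = refl
  ... | yes x<n | no y≮n = ⊥-elim (y≮n (x→y x<n))
  ... | no x≮n | yes y<n = ⊥-elim (x≮n (y→x y<n))

  mirror<n⇒n≤ : ∀ {x} → x < N → mirror x < n → n ≤ x
  mirror<n⇒n≤ {x} x<N -x<n with n ≤? x
  ... | yes n≤x = n≤x
  ... | no n≰x = ⊥-elim (<⇒≱ -x<n (n≤mirror (≰⇒> n≰x)))

  SameHalf-mirror : ∀ {x y} → x < N → y < N → SameHalf x y → SameHalf (mirror x) (mirror y)
  SameHalf-mirror x<N y<N (x→y , y→x) =
    (λ -x<n → mirror<n (n≤-of y→x (mirror<n⇒n≤ x<N -x<n))) ,
    (λ -y<n → mirror<n (n≤-of x→y (mirror<n⇒n≤ y<N -y<n)))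
    where
    n≤-of : ∀ {u v} → (u < n → v < n) → n ≤ v → n ≤ u
    n≤-of {u} u→v n≤v = ≮⇒≥ (λ u<n → <⇒≱ (u→v u<n) n≤v)

  #below-map-range-cong : ∀ {h h'} a L → (∀ k → a ≤ k → k < a + L → iverson (h k <? n) ≡ iverson (h' k <? n)) →
    #below n (map h (range a L)) ≡ #below n (map h' (range a L))
  #below-map-range-cong a zero e = refl
  #below-map-range-cong a (suc L) e = cong₂ _+_
    (e a ≤-refl (subst (a <_) (sym (+-suc a L)) (m≤m+n (suc a) L)))
    (#below-map-range-cong (suc a) L (λ k a<k k<aL → e k (<⇒≤ a<k) (subst (k <_) (sym (+-suc a L)) k<aL)))

  -- Across the halves (a < n ≤ b) the reflection exchanges the positive positions b and mirror a,
  -- whose values G a, G b and their mirrors lie in the same half by assumption.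
  negativesOn-reflection-across : ∀ {G a b} → Odd G → Bounded G → a < n → n ≤ b → b < N → a ≢ mirror b →
    SameHalf (G a) (G b) → negativesOn (G ∘ reflectionKey a b) ≡ negativesOn G
  negativesOn-reflection-across {G} {a} {b} G-odd G<N a<n n≤b b<N a≢-b same-values =
    #below-map-range-cong n n (λ k n≤k _ → by-cases k n≤k (k ≟ b) (k ≟ mirror a))
    where
    a<N = <-trans a<n n<N
    open Reflection a<N b<N a≢-b
    by-cases : ∀ k → n ≤ k → Dec (k ≡ b) → Dec (k ≡ mirror a) →
      iverson (G (reflectionKey a b k) <? n) ≡ iverson (G k <? n)
    by-cases k _ (yes refl) _ = begin
      iverson (G (transpose a k (transpose (mirror a) (mirror k) k)) <? n)
        ≡⟨ cong (λ z → iverson (G (transpose a k z) <? n)) (transpose-other b≢-a (≢-sym (mirror-≢ b<N))) ⟩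
      iverson (G (transpose a k k) <? n)
        ≡⟨ cong (λ z → iverson (G z <? n)) (transpose-right a k) ⟩
      iverson (G a <? n)
        ≡⟨ SameHalf-iverson same-values ⟩
      iverson (G k <? n) ∎
      where open ≡-Reasoning
    by-cases k _ (no _) (yes refl) = begin
      iverson (G (transpose a b (transpose k (mirror b) k)) <? n)
        ≡⟨ cong (λ z → iverson (G (transpose a b z) <? n)) (transpose-left k (mirror b)) ⟩
      iverson (G (transpose a b (mirror b)) <? n)
        ≡⟨ cong (λ z → iverson (G z <? n)) (transpose-other (≢-sym a≢-b) (mirror-≢ b<N)) ⟩
      iverson (G (mirror b) <? n)
        ≡⟨ cong (λ z → iverson (z <? n)) (G-odd b b<N) ⟩
      iverson (mirror (G b) <? n)
        ≡⟨ SameHalf-iverson (SameHalf-mirror (G<N b b<N) (G<N a a<N) (SameHalf-sym same-values)) ⟩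
      iverson (mirror (G a) <? n)
        ≡⟨ cong (λ z → iverson (z <? n)) (G-odd a a<N) ⟨
      iverson (G k <? n) ∎
      where open ≡-Reasoning
    by-cases k n≤k (no k≢b) (no k≢-a) = cong (λ z → iverson (G z <? n)) (trans
      (cong (transpose a b) (transpose-other k≢-a (≢-sym (<⇒≢ (<-≤-trans (mirror<n n≤b) n≤k)))))
      (transpose-other (≢-sym (<⇒≢ (<-≤-trans a<n n≤k))) k≢b))

  -- Within one half, the reflection permutes the positive positions among themselves.
  negativesOn-reflection : ∀ {G a b} → Odd G → Bounded G → a < b → b < N → a ≢ mirror b →
    SameHalf a b ⊎ SameHalf (G a) (G b) → negativesOn (G ∘ reflectionKey a b) ≡ negativesOn G
  negativesOn-reflection {G} {a} {b} G-odd G<N a<b b<N a≢-b same with a <? n | b <? n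
  ... | no a≮n | _ = trans
    (negativesOn-transpose-negative (G ∘ transpose a b) (mirror<n (≮⇒≥ a≮n)) (mirror<n (≤-trans (≮⇒≥ a≮n) (<⇒≤ a<b))))
    (negativesOn-transpose-positive G (≮⇒≥ a≮n) a<b b<N)
  ... | yes a<n | yes b<n = trans
    (cong (#below n) (map-cong (λ k → cong (G ∘ transpose a b) (transpose-sym (mirror a) (mirror b) k)) (range n n)))
    (trans (negativesOn-transpose-positive (G ∘ transpose a b) (n≤mirror b<n) (mirror-reverses a<b b<N)
                                           (mirror-< (<-trans a<b b<N)))
           (negativesOn-transpose-negative G a<n b<n))
  ... | yes a<n | no b≮n with same
  ...   | inj₁ (a→b , _) = ⊥-elim (b≮n (a→b a<n))
  ...   | inj₂ same-values = negativesOn-reflection-across G-odd G<N a<n (≮⇒≥ b≮n) b<N a≢-b same-values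

  Linked : (ℕ → ℕ) → ℕ → ℕ → Set
  Linked G a b = Cover G a b × Cover G b a

  Linked-sym : ∀ {G a b} → Linked G a b → Linked G b a
  Linked-sym (cover-ab , cover-ba) = cover-ba , cover-ab

  doubleLength-drop⇒linked : ∀ {G a b} → Odd G → Bounded G → Injective<N G → a < N → b < N → a ≢ mirror b →
    SameHalf a b ⊎ SameHalf (G a) (G b) →
    2 + doubleLength (G ∘ reflectionKey a b) ≡ doubleLength G → Linked G a b
  doubleLength-drop⇒linked {G} {a} {b} G-odd G<N G-inj a<N b<N a≢-b same drop =
    cover a<N b<N a≢-b same drop ,
    cover b<N a<N b≢-a (Sum.map SameHalf-sym SameHalf-sym same)
      (trans (cong (2 +_) (doubleLength-cong (λ k _ → cong G (reflectionKey-sym a b k)))) drop)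
    where
    open Reflection a<N b<N a≢-b using (b≢-a)
    cover : ∀ {a b} → a < N → b < N → a ≢ mirror b → SameHalf a b ⊎ SameHalf (G a) (G b) →
      2 + doubleLength (G ∘ reflectionKey a b) ≡ doubleLength G → Cover G a b
    cover {a} {b} a<N b<N a≢-b same drop a<b = reflection-drop⇒cover G-odd G<N G-inj b<N a≢-b
      (+-cancelʳ-≡ (negativesOn G) _ _ (begin
        2 + inversionsOn (G ∘ reflectionKey a b) + negativesOn G
          ≡⟨ cong (2 + inversionsOn (G ∘ reflectionKey a b) +_)
               (negativesOn-reflection G-odd G<N a<b b<N a≢-b same) ⟨
        2 + inversionsOn (G ∘ reflectionKey a b) + negativesOn (G ∘ reflectionKey a b)
          ≡⟨ +-assoc 2 (inversionsOn (G ∘ reflectionKey a b)) (negativesOn (G ∘ reflectionKey a b)) ⟩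
        2 + doubleLength (G ∘ reflectionKey a b)
          ≡⟨ drop ⟩
        doubleLength G ∎)) a<b
      where open ≡-Reasoning

  inv-odd : ∀ (π : B n) z → inv π (neg z) ≡ neg (inv π z)
  inv-odd π z = begin
    inv π (neg z)                     ≡⟨ cong (inv π ∘ neg) (inv-r π z) ⟨
    inv π (neg (fun π (inv π z)))     ≡⟨ cong (inv π) (odd π (inv π z)) ⟨
    inv π (fun π (neg (inv π z)))     ≡⟨ inv-l π (neg (inv π z)) ⟩
    neg (inv π z)                     ∎
    where open ≡-Reasoning

  key-u : ∀ {x y} → x ≢ neg y → ∀ z → key (u x y z) ≡ reflectionKey (key x) (key y) (key z)
  key-u {x} {y} x≢-y z with x ≟SE neg y
  ... | yes x≡-y = ⊥-elim (x≢-y x≡-y)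
  ... | no _ = begin
    key (t x y (t (neg x) (neg y) z))
      ≡⟨ key-t x y (t (neg x) (neg y) z) ⟩
    transpose (key x) (key y) (key (t (neg x) (neg y) z))
      ≡⟨ cong (transpose (key x) (key y)) (key-t (neg x) (neg y) z) ⟩
    transpose (key x) (key y) (transpose (key (neg x)) (key (neg y)) (key z))
      ≡⟨ cong (transpose (key x) (key y)) (cong₂ (λ c d → transpose c d (key z)) (key-neg x) (key-neg y)) ⟩
    reflectionKey (key x) (key y) (key z) ∎
    where open ≡-Reasoning

  SameSign⇒SameHalf : ∀ {z w : SE n} → SameSign z w → SameHalf (key z) (key w)
  SameSign⇒SameHalf {true , i} {true , j} _ =
    (λ k<n → ⊥-elim (<⇒≱ k<n (n≤key-positive i))) , (λ k<n → ⊥-elim (<⇒≱ k<n (n≤key-positive j)))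
  SameSign⇒SameHalf {false , i} {false , j} _ = (λ _ → key-negative<n j) , (λ _ → key-negative<n i)

  key≢mirror : ∀ {x y} → x ≢ neg y → key x ≢ mirror (key y)
  key≢mirror {x} {y} x≢-y e = x≢-y (key-injective (trans e (sym (key-neg y))))

  u-involutive : ∀ {x y} → x ≢ neg y → ∀ z → u x y (u x y z) ≡ z
  u-involutive {x} {y} x≢-y z = key-injective (begin
    key (u x y (u x y z))                                         ≡⟨ key-u x≢-y (u x y z) ⟩
    reflectionKey (key x) (key y) (key (u x y z))                 ≡⟨ cong (reflectionKey (key x) (key y)) (key-u x≢-y z) ⟩
    reflectionKey (key x) (key y) (reflectionKey (key x) (key y) (key z)) ≡⟨ reflectionKey-involutive (key z) ⟩
    key z                                                         ∎)
    where
    open ≡-Reasoning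
    open Reflection (key<N x) (key<N y) (key≢mirror x≢-y)

  u-odd : ∀ {x y} → x ≢ neg y → ∀ z → u x y (neg z) ≡ neg (u x y z)
  u-odd {x} {y} x≢-y z = key-injective (begin
    key (u x y (neg z))                                 ≡⟨ key-u x≢-y (neg z) ⟩
    reflectionKey (key x) (key y) (key (neg z))         ≡⟨ cong (reflectionKey (key x) (key y)) (key-neg z) ⟩
    reflectionKey (key x) (key y) (mirror (key z))      ≡⟨ reflectionKey-odd (key z) (key<N z) ⟩
    mirror (reflectionKey (key x) (key y) (key z))      ≡⟨ cong mirror (key-u x≢-y z) ⟨
    mirror (key (u x y z))                              ≡⟨ key-neg (u x y z) ⟨
    key (neg (u x y z))                                 ∎)
    where
    open ≡-Reasoning
    open Reflection (key<N x) (key<N y) (key≢mirror x≢-y)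

  inv-injective : ∀ (π : B n) p q → inv π p ≡ inv π q → p ≡ q
  inv-injective π p q e = trans (sym (inv-r π p)) (trans (cong (fun π) e) (inv-r π q))

  adjacent⇒linked : ∀ (π : B n) {x y} → Adj π x y → x ≢ neg y → Linked (onKeys (inv π)) (key x) (key y)
  adjacent⇒linked π {x} {y} (_ , u-defined , k , ℓπ≡1+k , ℓuπ≡k) x≢-y = doubleLength-drop⇒linked
    (onKeys-odd (inv-odd π)) (onKeys-bounded (inv π)) (onKeys-injective (inv-injective π))
    (key<N x) (key<N y) (key≢mirror x≢-y) (same-half u-defined) drop
    where
    open Reflection (key<N x) (key<N y) (key≢mirror x≢-y) using (reflectionKey-bounded)
    ℓπ : doubleLength (onKeys (inv π)) ≡ 2 * suc k
    ℓπ = doubleLength≡2*length (inv-l π) (inv-r π) (inv-odd π) ℓπ≡1+k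
    ℓuπ : doubleLength (onKeys (inv π ∘ u x y)) ≡ 2 * k
    ℓuπ = doubleLength≡2*length {g = inv π ∘ u x y}
      (λ z → trans (cong (inv π) (u-involutive x≢-y (fun π z))) (inv-l π z))
      (λ z → trans (cong (u x y) (inv-r π (u x y z))) (u-involutive x≢-y z))
      (λ z → trans (cong (inv π) (u-odd x≢-y z)) (inv-odd π (u x y z))) ℓuπ≡k
    drop : 2 + doubleLength (onKeys (inv π) ∘ reflectionKey (key x) (key y)) ≡ doubleLength (onKeys (inv π))
    drop = begin
      2 + doubleLength (onKeys (inv π) ∘ reflectionKey (key x) (key y))
        ≡⟨ cong (2 +_) (doubleLength-cong (onKeys-∘ (inv π) {u x y} (key-u x≢-y) reflectionKey-bounded)) ⟨
      2 + doubleLength (onKeys (inv π ∘ u x y)) ≡⟨ cong (2 +_) ℓuπ ⟩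
      2 + 2 * k                                 ≡⟨ *-suc 2 k ⟨
      2 * suc k                                 ≡⟨ ℓπ ⟨
      doubleLength (onKeys (inv π))             ∎
      where open ≡-Reasoning
    same-half : UDefined π x y → SameHalf (key x) (key y) ⊎ SameHalf (onKeys (inv π) (key x)) (onKeys (inv π) (key y))
    same-half (inj₁ x≡-y) = ⊥-elim (x≢-y x≡-y)
    same-half (inj₂ (inj₁ same-sign)) = inj₁ (SameSign⇒SameHalf same-sign)
    same-half (inj₂ (inj₂ same-sign)) = inj₂ (subst₂ SameHalf
      (cong (key ∘ inv π) (sym (unkey-key x))) (cong (key ∘ inv π) (sym (unkey-key y))) (SameSign⇒SameHalf same-sign))

module Triangles (m : ℕ) where

  open Keys m
  open Covers m

  OppositeHalves : ℕ → ℕ → Set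
  OppositeHalves p q = (p < n → n ≤ q) × (n ≤ p → q < n)

  OppositeHalves-sym : ∀ {p q} → OppositeHalves p q → OppositeHalves q p
  OppositeHalves-sym {p} {q} (p<n→ , n≤p→) =
    (λ q<n → ≮⇒≥ (λ p<n → <⇒≱ q<n (p<n→ p<n))) ,
    (λ n≤q → ≰⇒> (λ n≤p → <⇒≱ (n≤p→ n≤p) n≤q))

  -- The key-level shape of the edges {x, y} and {x, -y} of Γ for elements of π[n].
  Edge₋ Edge : (ℕ → ℕ) → ℕ → ℕ → Set
  Edge₋ G p q = Linked G p (mirror q) × OppositeHalves p q
  Edge G p q = Linked G p q ⊎ Edge₋ G p q

  mirror-flipˡ : ∀ {x y} → y < N → x < mirror y → y < mirror x
  mirror-flipˡ {x} {y} y<N x<-y = subst (_< mirror x) (mirror-involutive y<N) (mirror-reverses x<-y (mirror-< y<N))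

  mirror-flipʳ : ∀ {x y} → x < N → y < N → mirror y < x → mirror x < y
  mirror-flipʳ {x} {y} x<N y<N -y<x = subst (mirror x <_) (mirror-involutive y<N) (mirror-reverses -y<x x<N)

  module _ {G : ℕ → ℕ} (G-odd : Odd G) (G<N : Bounded G) (G-inj : Injective<N G) where

    Cover-mirror : ∀ {p q} → p < N → q < N → Cover G p q → Cover G (mirror q) (mirror p)
    Cover-mirror {p} {q} p<N q<N cover -q<-p with <-cmp p q
    ... | tri≈ _ refl _ = ⊥-elim (<-irrefl refl -q<-p)
    ... | tri> _ _ q<p = ⊥-elim (<-asym -q<-p (mirror-reverses q<p p<N))
    ... | tri< p<q _ _ = G-p<G-q , nothing-between
      where
      G-p<G-q : G (mirror p) < G (mirror q)
      G-p<G-q = subst₂ _<_ (sym (G-odd p p<N)) (sym (G-odd q q<N)) (mirror-reverses (proj₁ (cover p<q)) (G<N p p<N))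
      nothing-between : ∀ z → mirror q < z → z < mirror p → G (mirror p) < G z → G z < G (mirror q) → ⊥
      nothing-between z -q<z z<-p G-p<Gz Gz<G-q = proj₂ (cover p<q) (mirror z)
        (mirror-flipˡ p<N z<-p) (mirror-flipʳ z<N q<N -q<z)
        (subst (G q <_) (sym (G-odd z z<N)) (mirror-flipˡ (G<N q q<N) (subst (G z <_) (G-odd q q<N) Gz<G-q)))
        (subst (_< G p) (sym (G-odd z z<N)) (mirror-flipʳ (G<N z z<N) (G<N p p<N) (subst (_< G z) (G-odd p p<N) G-p<Gz)))
        where
        z<N : z < N
        z<N = <-trans z<-p (mirror-< p<N)

    Linked-mirror : ∀ {p q} → p < N → q < N → Linked G p q → Linked G (mirror p) (mirror q)
    Linked-mirror p<N q<N (cover-pq , cover-qp) = Cover-mirror q<N p<N cover-qp , Cover-mirror p<N q<N cover-pq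

    Edge₋-sym : ∀ {p q} → p < N → q < N → Edge₋ G p q → Edge₋ G q p
    Edge₋-sym {p} {q} p<N q<N (linked , opposite) =
      Linked-sym (subst (Linked G (mirror p)) (mirror-involutive q<N) (Linked-mirror p<N (mirror-< q<N) linked)) ,
      OppositeHalves-sym opposite

    Edge-sym : ∀ {p q} → p < N → q < N → Edge G p q → Edge G q p
    Edge-sym p<N q<N (inj₁ linked) = inj₁ (Linked-sym linked)
    Edge-sym p<N q<N (inj₂ edge₋) = inj₂ (Edge₋-sym p<N q<N edge₋)

    NothingBetween : ℕ → ℕ → ℕ → ℕ → Set
    NothingBetween p q lo hi = ∀ z → p < z → z < q → lo < G z → G z < hi → ⊥

    G-mirror<n : ∀ {q} → q < N → n ≤ G q → G (mirror q) < n
    G-mirror<n q<N n≤Gq = subst (_< n) (sym (G-odd _ q<N)) (mirror<n n≤Gq)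

    Edge₋-shape : ∀ {p q} → p < N → q < N → n ≤ G p → n ≤ G q → Linked G p (mirror q) →
      p < mirror q × NothingBetween p (mirror q) (mirror (G q)) (G p)
    Edge₋-shape {p} {q} p<N q<N n≤Gp n≤Gq (cover , cover') with <-cmp p (mirror q)
    ... | tri≈ _ refl _ = ⊥-elim (<⇒≱ (G-mirror<n q<N n≤Gq) n≤Gp)
    ... | tri> _ _ -q<p = ⊥-elim (<⇒≱ (<-trans (proj₁ (cover' -q<p)) (G-mirror<n q<N n≤Gq)) n≤Gp)
    ... | tri< p<-q _ _ = p<-q , λ z p<z z<-q -Gq<Gz Gz<Gp →
      proj₂ (cover p<-q) z p<z z<-q (subst (_< G z) (sym (G-odd q q<N)) -Gq<Gz) Gz<Gp

    Edge⇒Linked-positive : ∀ {p q} → n ≤ p → n ≤ q → Edge G p q → Linked G p q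
    Edge⇒Linked-positive _ _ (inj₁ linked) = linked
    Edge⇒Linked-positive n≤p n≤q (inj₂ (_ , _ , n≤p→)) = ⊥-elim (<⇒≱ (n≤p→ n≤p) n≤q)

    Edge⇒Linked-negative : ∀ {p q} → p < n → q < n → Edge G p q → Linked G p q
    Edge⇒Linked-negative _ _ (inj₁ linked) = linked
    Edge⇒Linked-negative p<n q<n (inj₂ (_ , p<n→ , _)) = ⊥-elim (<⇒≱ q<n (p<n→ p<n))

    -- In the two lemmas below x < n ≤ y carry both edges {x, y} and {x, -y}; a third key w
    -- joined to both of them always falls into one of the forbidden windows.
    no-double-edge-positive-third : ∀ {x y w} → x < N → y < N → w < N → n ≤ G x → n ≤ G y → n ≤ G w →
      x < n → n ≤ y → n ≤ w → w ≢ y → Linked G x y → Edge₋ G x y → Edge G x w → Linked G y w → ⊥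
    no-double-edge-positive-third {x} {y} {w} x<N y<N w<N n≤Gx n≤Gy n≤Gw x<n n≤y n≤w w≢y
      linked-xy (linked-x-y , _) edge-xw linked-yw with <-cmp w y
    ... | tri≈ _ w≡y _ = w≢y w≡y
    ... | tri< w<y _ _ with edge-xw
    ...   | inj₁ linked-xw = <-asym Gx<Gw (proj₁ (proj₁ linked-xw x<w))
      where
      x<w = <-≤-trans x<n n≤w
      Gy<Gw = proj₁ (proj₂ linked-yw w<y)
      Gx<Gw = ≤∧≢⇒< (≮⇒≥ (proj₂ (proj₁ linked-xy (<-≤-trans x<n n≤y)) w x<w w<y Gy<Gw))
                     (λ Gx≡Gw → <-irrefl (G-inj x w x<N w<N Gx≡Gw) x<w)
    ...   | inj₂ (linked-x-w , _) =
      proj₂ (Edge₋-shape x<N w<N n≤Gx n≤Gw linked-x-w) (mirror y)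
        (proj₁ (Edge₋-shape x<N y<N n≤Gx n≤Gy linked-x-y)) (mirror-reverses w<y y<N)
        (subst (mirror (G w) <_) (sym (G-odd y y<N)) (mirror-reverses (proj₁ (proj₂ linked-yw w<y)) (G<N w w<N)))
        (<-≤-trans (G-mirror<n y<N n≤Gy) n≤Gx)
    no-double-edge-positive-third {x} {y} {w} x<N y<N w<N n≤Gx n≤Gy n≤Gw x<n n≤y n≤w w≢y
      linked-xy (linked-x-y , _) edge-xw linked-yw | tri> _ _ y<w with edge-xw
    ...   | inj₁ linked-xw = proj₂ (proj₁ linked-xw (<-≤-trans x<n n≤w)) y (<-≤-trans x<n n≤y) y<w
        (proj₁ (proj₁ linked-yw y<w)) (proj₁ (proj₁ linked-xy (<-≤-trans x<n n≤y)))
    ...   | inj₂ (linked-x-w , _) =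
      proj₂ (Edge₋-shape x<N y<N n≤Gx n≤Gy linked-x-y) (mirror w)
        (proj₁ (Edge₋-shape x<N w<N n≤Gx n≤Gw linked-x-w)) (mirror-reverses y<w w<N)
        (subst (mirror (G y) <_) (sym (G-odd w w<N)) (mirror-reverses (proj₁ (proj₁ linked-yw y<w)) (G<N y y<N)))
        (<-≤-trans (G-mirror<n w<N n≤Gw) n≤Gx)

    no-double-edge-negative-third : ∀ {x y w} → x < N → y < N → w < N → n ≤ G x → n ≤ G y → n ≤ G w →
      x < n → n ≤ y → w < n → w ≢ x → Linked G x y → Edge₋ G x y → Linked G x w → Edge G w y → ⊥
    no-double-edge-negative-third {x} {y} {w} x<N y<N w<N n≤Gx n≤Gy n≤Gw x<n n≤y w<n w≢x
      linked-xy (linked-x-y , _) linked-xw edge-wy with <-cmp w x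
    ... | tri≈ _ w≡x _ = w≢x w≡x
    ... | tri< w<x _ _ with edge-wy
    ...   | inj₁ linked-wy = proj₂ (proj₁ linked-wy (<-≤-trans w<n n≤y)) x w<x (<-≤-trans x<n n≤y)
        (proj₁ (proj₁ linked-xy (<-≤-trans x<n n≤y))) (proj₁ (proj₂ linked-xw w<x))
    ...   | inj₂ (linked-w-y , _) = proj₂ (Edge₋-shape w<N y<N n≤Gw n≤Gy linked-w-y) x w<x
        (proj₁ (Edge₋-shape x<N y<N n≤Gx n≤Gy linked-x-y))
        (<-≤-trans (mirror<n n≤Gy) n≤Gx) (proj₁ (proj₂ linked-xw w<x))
    no-double-edge-negative-third {x} {y} {w} x<N y<N w<N n≤Gx n≤Gy n≤Gw x<n n≤y w<n w≢x
      linked-xy (linked-x-y , _) linked-xw edge-wy | tri> _ _ x<w with edge-wy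
    ...   | inj₁ linked-wy = <-asym Gw<Gy (proj₁ (proj₁ linked-wy w<y))
      where
      w<y = <-≤-trans w<n n≤y
      Gw<Gx = proj₁ (proj₁ linked-xw x<w)
      Gw<Gy = ≤∧≢⇒< (≮⇒≥ (λ Gy<Gw → proj₂ (proj₁ linked-xy (<-≤-trans x<n n≤y)) w x<w w<y Gy<Gw Gw<Gx))
                     (λ Gw≡Gy → <-irrefl (G-inj w y w<N y<N Gw≡Gy) w<y)
    ...   | inj₂ (linked-w-y , _) = proj₂ (Edge₋-shape x<N y<N n≤Gx n≤Gy linked-x-y) w x<w
        (proj₁ (Edge₋-shape w<N y<N n≤Gw n≤Gy linked-w-y))
        (<-≤-trans (mirror<n n≤Gy) n≤Gw) (proj₁ (proj₁ linked-xw x<w))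

    no-double-edge-from-negative : ∀ {x y w} → x < N → y < N → w < N → n ≤ G x → n ≤ G y → n ≤ G w →
      x < n → w ≢ x → w ≢ y → Linked G x y → Edge₋ G x y → Edge G x w → Edge G y w → ⊥
    no-double-edge-from-negative {x} {y} {w} x<N y<N w<N n≤Gx n≤Gy n≤Gw x<n w≢x w≢y linked-xy edge₋-xy edge-xw edge-yw
      with n ≤? w
    ... | yes n≤w = no-double-edge-positive-third x<N y<N w<N n≤Gx n≤Gy n≤Gw x<n n≤y n≤w w≢y
                      linked-xy edge₋-xy edge-xw (Edge⇒Linked-positive n≤y n≤w edge-yw)
      where n≤y = proj₁ (proj₂ edge₋-xy) x<n
    ... | no n≰w = no-double-edge-negative-third x<N y<N w<N n≤Gx n≤Gy n≤Gw x<n (proj₁ (proj₂ edge₋-xy) x<n) w<n w≢x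
                     linked-xy edge₋-xy (Edge⇒Linked-negative x<n w<n edge-xw) (Edge-sym y<N w<N edge-yw)
      where w<n = ≰⇒> n≰w

    -- α(x, y) ≤ 1 for x, y in π[n] as soon as both x and y are joined to a third element.
    no-double-edge : ∀ {x y w} → x < N → y < N → w < N → n ≤ G x → n ≤ G y → n ≤ G w → w ≢ x → w ≢ y →
      Linked G x y → Edge₋ G x y → Edge G x w → Edge G y w → ⊥
    no-double-edge {x} x<N y<N w<N n≤Gx n≤Gy n≤Gw w≢x w≢y linked-xy edge₋-xy edge-xw edge-yw with x <? n
    ... | yes x<n = no-double-edge-from-negative x<N y<N w<N n≤Gx n≤Gy n≤Gw x<n w≢x w≢y
                      linked-xy edge₋-xy edge-xw edge-yw
    ... | no x≮n = no-double-edge-from-negative y<N x<N w<N n≤Gy n≤Gx n≤Gw (proj₂ (proj₂ edge₋-xy) (≮⇒≥ x≮n)) w≢y w≢x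
                     (Linked-sym linked-xy) (Edge₋-sym x<N y<N edge₋-xy) edge-yw edge-xw

  -- The middle key of three pairwise linked ones lies between the outer two in position and value.
  no-linked-triangle : ∀ {G p q r} → p < q → q < r → Linked G p q → Linked G q r → Linked G p r → ⊥
  no-linked-triangle p<q q<r (cover-pq , _) (cover-qr , _) (cover-pr , _) =
    proj₂ (cover-pr (<-trans p<q q<r)) _ p<q q<r (proj₁ (cover-qr q<r)) (proj₁ (cover-pq p<q))

  no-linked-triple : ∀ {G x y w} → x ≢ y → x ≢ w → y ≢ w → Linked G x y → Linked G x w → Linked G y w → ⊥
  no-linked-triple {x = x} {y} {w} x≢y x≢w y≢w xy xw yw with <-cmp x y | <-cmp y w | <-cmp x w
  ... | tri≈ _ x≡y _ | _ | _ = x≢y x≡y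
  ... | _ | tri≈ _ y≡w _ | _ = y≢w y≡w
  ... | _ | _ | tri≈ _ x≡w _ = x≢w x≡w
  ... | tri< x<y _ _ | tri< y<w _ _ | _ = no-linked-triangle x<y y<w xy yw xw
  ... | tri< x<y _ _ | tri> _ _ w<y | tri< x<w _ _ = no-linked-triangle x<w w<y xw (Linked-sym yw) xy
  ... | tri< x<y _ _ | tri> _ _ w<y | tri> _ _ w<x = no-linked-triangle w<x x<y (Linked-sym xw) xy (Linked-sym yw)
  ... | tri> _ _ y<x | tri< y<w _ _ | tri< x<w _ _ = no-linked-triangle y<x x<w (Linked-sym xy) xw yw
  ... | tri> _ _ y<x | tri< y<w _ _ | tri> _ _ w<x = no-linked-triangle y<w w<x yw (Linked-sym xw) (Linked-sym xy)
  ... | tri> _ _ y<x | tri> _ _ w<y | _ = no-linked-triangle w<y y<x (Linked-sym yw) (Linked-sym xy) (Linked-sym xw)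

module EdgeValues {m : ℕ} (π : B (suc m)) where

  EVal-adjacent : ∀ {x y e} → EVal π x y e → 0 < e → Adj π x y
  EVal-adjacent (inj₁ (adjacent , _)) _ = adjacent
  EVal-adjacent (inj₂ (_ , refl)) ()

  EVal≡0 : ∀ {x y e} → EVal π x y e → ¬ Adj π x y → e ≡ 0
  EVal≡0 (inj₁ (adjacent , _)) ¬adjacent = ⊥-elim (¬adjacent adjacent)
  EVal≡0 (inj₂ (_ , e≡0)) _ = e≡0

  EVal≤1 : ∀ {x y e} → EVal π x y e → e ≤ 1
  EVal≤1 (inj₁ (_ , refl)) = ≤-refl
  EVal≤1 (inj₂ (_ , refl)) = z≤n

  EVal-sum≤1 : ∀ {x y x' y' e e'} → EVal π x y e → EVal π x' y' e' → (Adj π x y → Adj π x' y' → ⊥) → e + e' ≤ 1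
  EVal-sum≤1 (inj₁ (adjacent , refl)) (inj₁ (adjacent' , refl)) not-both = ⊥-elim (not-both adjacent adjacent')
  EVal-sum≤1 (inj₁ (_ , refl)) (inj₂ (_ , refl)) _ = ≤-refl
  EVal-sum≤1 (inj₂ (_ , refl)) E' _ = EVal≤1 E'

  EVal-positive : ∀ {x y x' y' e e'} → EVal π x y e → EVal π x' y' e' → 0 < e + e' → Adj π x y ⊎ Adj π x' y'
  EVal-positive (inj₁ (adjacent , _)) _ _ = inj₁ adjacent
  EVal-positive (inj₂ (_ , refl)) E' 0<e' = inj₂ (EVal-adjacent E' 0<e')

  EVal-sum≤2 : ∀ {x₁ y₁ x₂ y₂ x₃ y₃ e₁ e₂ e₃} → EVal π x₁ y₁ e₁ → EVal π x₂ y₂ e₂ → EVal π x₃ y₃ e₃ →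
    (Adj π x₁ y₁ → Adj π x₂ y₂ → Adj π x₃ y₃ → ⊥) → e₁ + e₂ + e₃ ≤ 2
  EVal-sum≤2 (inj₂ (_ , refl)) E₂ E₃ _ = +-mono-≤ (EVal≤1 E₂) (EVal≤1 E₃)
  EVal-sum≤2 (inj₁ (_ , refl)) (inj₂ (_ , refl)) E₃ _ = s≤s (EVal≤1 E₃)
  EVal-sum≤2 (inj₁ (a₁ , refl)) (inj₁ (a₂ , refl)) E₃ not-all = s≤s (s≤s (≤-reflexive (EVal≡0 E₃ (not-all a₁ a₂))))

module Images (m : ℕ) (π : B (suc m)) where

  open Keys m
  open Covers m
  open Triangles m
  open EdgeValues π

  -- The key image of π⁻¹; an element x lies in π[n] iff G (key x) is a positive key.
  G : ℕ → ℕ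
  G = onKeys (inv π)

  G-odd : Odd G
  G-odd = onKeys-odd (inv-odd π)

  G-bounded : Bounded G
  G-bounded = onKeys-bounded (inv π)

  G-injective : Injective<N G
  G-injective = onKeys-injective (inv-injective π)

  inv-image : ∀ {x} → InImage π x → ∃ λ i → inv π x ≡ pos i
  inv-image (i , πi≡x) = i , trans (cong (inv π) (sym πi≡x)) (inv-l π (pos i))

  n≤G-key : ∀ {x} → InImage π x → n ≤ G (key x)
  n≤G-key {x} x∈π[n] with inv-image x∈π[n]
  ... | i , π⁻¹x≡i = subst (n ≤_) (cong key (sym (trans (cong (inv π) (unkey-key x)) π⁻¹x≡i))) (n≤key-positive i)

  image-≢-neg : ∀ {x y} → InImage π x → InImage π y → x ≢ neg y
  image-≢-neg {x} {y} x∈π[n] y∈π[n] x≡-y with inv-image x∈π[n] | inv-image y∈π[n]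
  ... | i , π⁻¹x≡i | j , π⁻¹y≡j with trans (sym π⁻¹x≡i) (trans (cong (inv π) x≡-y) (trans (inv-odd π y) (cong neg π⁻¹y≡j)))
  ... | ()

  neg-involutive : ∀ (z : SE n) → neg (neg z) ≡ z
  neg-involutive (true , i) = refl
  neg-involutive (false , i) = refl

  adjacent⇒Linked : ∀ {x y} → InImage π x → InImage π y → Adj π x y → Linked G (key x) (key y)
  adjacent⇒Linked x∈π[n] y∈π[n] adjacent = adjacent⇒linked π adjacent (image-≢-neg x∈π[n] y∈π[n])

  opposite-sign⇒OppositeHalves : ∀ {x y : SE n} → proj₁ x ≡ not (proj₁ y) → OppositeHalves (key x) (key y)
  opposite-sign⇒OppositeHalves {true , i} {false , j} _ =
    (λ k<n → ⊥-elim (<⇒≱ k<n (n≤key-positive i))) , (λ _ → key-negative<n j)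
  opposite-sign⇒OppositeHalves {false , i} {true , j} _ =
    (λ _ → n≤key-positive j) , (λ n≤k → ⊥-elim (<⇒≱ (key-negative<n i) n≤k))

  adjacent-neg⇒Edge₋ : ∀ {x y} → InImage π x → InImage π y → x ≢ y → Adj π x (neg y) → Edge₋ G (key x) (key y)
  adjacent-neg⇒Edge₋ {x} {y} x∈π[n] y∈π[n] x≢y adjacent =
    subst (Linked G (key x)) (key-neg y) (adjacent⇒linked π adjacent (λ e → x≢y (trans e (neg-involutive y)))) ,
    opposite (proj₁ (proj₂ adjacent))
    where
    opposite : UDefined π x (neg y) → OppositeHalves (key x) (key y)
    opposite (inj₁ x≡--y) = ⊥-elim (x≢y (trans x≡--y (neg-involutive y)))
    opposite (inj₂ (inj₁ opposite-sign)) = opposite-sign⇒OppositeHalves opposite-sign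
    opposite (inj₂ (inj₂ same-preimage-sign)) with inv-image x∈π[n] | inv-image y∈π[n]
    ... | i , π⁻¹x≡i | j , π⁻¹y≡j with trans (sym (cong proj₁ π⁻¹x≡i))
          (trans same-preimage-sign (cong proj₁ (trans (inv-odd π y) (cong neg π⁻¹y≡j))))
    ... | ()

  SameSign⇒¬OppositeHalves : ∀ {x y : SE n} → SameSign x y → ¬ OppositeHalves (key x) (key y)
  SameSign⇒¬OppositeHalves {x} {y} same (x<n→ , n≤x→) with SameSign⇒SameHalf {x} {y} same | key x <? n
  ... | x→y , _ | yes x<n = <⇒≱ (x→y x<n) (x<n→ x<n)
  ... | _ , y→x | no x≮n = x≮n (y→x (n≤x→ (≮⇒≥ x≮n)))

  α-positive⇒Edge : ∀ {x y e e'} → InImage π x → InImage π y → x ≢ y →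
    EVal π x y e → EVal π x (neg y) e' → 0 < e + e' → Edge G (key x) (key y)
  α-positive⇒Edge x∈π[n] y∈π[n] x≢y E E' 0<α with EVal-positive E E' 0<α
  ... | inj₁ adjacent = inj₁ (adjacent⇒Linked x∈π[n] y∈π[n] adjacent)
  ... | inj₂ adjacent = inj₂ (adjacent-neg⇒Edge₋ x∈π[n] y∈π[n] x≢y adjacent)

  α≤1 : ∀ {x y w e e'} → InImage π x → InImage π y → InImage π w → x ≢ y → w ≢ x → w ≢ y →
    EVal π x y e → EVal π x (neg y) e' → Edge G (key x) (key w) → Edge G (key y) (key w) → e + e' ≤ 1
  α≤1 {x} {y} {w} x∈π[n] y∈π[n] w∈π[n] x≢y w≢x w≢y E E' edge-xw edge-yw =
    EVal-sum≤1 E E' λ adjacent adjacent-neg →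
      no-double-edge G-odd G-bounded G-injective (key<N x) (key<N y) (key<N w)
        (n≤G-key x∈π[n]) (n≤G-key y∈π[n]) (n≤G-key w∈π[n])
        (w≢x ∘ key-injective) (w≢y ∘ key-injective)
        (adjacent⇒Linked x∈π[n] y∈π[n] adjacent) (adjacent-neg⇒Edge₋ x∈π[n] y∈π[n] x≢y adjacent-neg) edge-xw edge-yw

  α≡e : ∀ {x y e e'} → InImage π x → InImage π y → x ≢ y → SameSign x y →
    EVal π x (neg y) e' → e + e' ≡ e
  α≡e {x} {y} {e} x∈π[n] y∈π[n] x≢y same E' = trans (cong (e +_)
    (EVal≡0 E' (SameSign⇒¬OppositeHalves {x} {y} same ∘ proj₂ ∘ adjacent-neg⇒Edge₋ x∈π[n] y∈π[n] x≢y)))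
    (+-identityʳ e)

  Edge-sym-key : ∀ {x y} → Edge G (key x) (key y) → Edge G (key y) (key x)
  Edge-sym-key {x} {y} = Edge-sym G-odd G-bounded G-injective (key<N x) (key<N y)

  no-three-edges : ∀ {x y w} → InImage π x → InImage π y → InImage π w → x ≢ y → x ≢ w → y ≢ w →
    Adj π x y → Adj π x w → Adj π y w → ⊥
  no-three-edges x∈π[n] y∈π[n] w∈π[n] x≢y x≢w y≢w xy xw yw = no-linked-triple
    (x≢y ∘ key-injective) (x≢w ∘ key-injective) (y≢w ∘ key-injective)
    (adjacent⇒Linked x∈π[n] y∈π[n] xy) (adjacent⇒Linked x∈π[n] w∈π[n] xw) (adjacent⇒Linked y∈π[n] w∈π[n] yw)

mainTheorem4 : ∀ (m : ℕ) (π : B (suc m)) (a b c : SE (suc m)) →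
    InImage π a → InImage π b → InImage π c →
    a ≢ b → a ≢ c → b ≢ c →
    ∀ (eab eab' eac eac' ebc ebc' : ℕ) →
    EVal π a b eab → EVal π a (neg b) eab' →
    EVal π a c eac → EVal π a (neg c) eac' →
    EVal π b c ebc → EVal π b (neg c) ebc' →
    ((0 < eab + eab' → 0 < eac + eac' → 0 < ebc + ebc' →
        (eab + eab') + (eac + eac') + (ebc + ebc') ≤ 3)
    × (SameSign a b → SameSign a c →
        (eab + eab') + (eac + eac') + (ebc + ebc') ≤ 2))
mainTheorem4 m π a b c a∈ b∈ c∈ a≢b a≢c b≢c eab eab' eac eac' ebc ebc' Eab Eab' Eac Eac' Ebc Ebc' =
  part-a , part-b
  where
  open Images m π
  open EdgeValues π
  part-a : 0 < eab + eab' → 0 < eac + eac' → 0 < ebc + ebc' → (eab + eab') + (eac + eac') + (ebc + ebc') ≤ 3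
  part-a 0<αab 0<αac 0<αbc = +-mono-≤ (+-mono-≤
      (α≤1 a∈ b∈ c∈ a≢b (≢-sym a≢c) (≢-sym b≢c) Eab Eab' edge-ac edge-bc)
      (α≤1 a∈ c∈ b∈ a≢c (≢-sym a≢b) b≢c Eac Eac' edge-ab (Edge-sym-key {b} {c} edge-bc)))
      (α≤1 b∈ c∈ a∈ b≢c a≢b a≢c Ebc Ebc' (Edge-sym-key {a} {b} edge-ab) (Edge-sym-key {a} {c} edge-ac))
    where
    edge-ab = α-positive⇒Edge a∈ b∈ a≢b Eab Eab' 0<αab
    edge-ac = α-positive⇒Edge a∈ c∈ a≢c Eac Eac' 0<αac
    edge-bc = α-positive⇒Edge b∈ c∈ b≢c Ebc Ebc' 0<αbc
  part-b : SameSign a b → SameSign a c → (eab + eab') + (eac + eac') + (ebc + ebc') ≤ 2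
  part-b ab ac = subst (_≤ 2)
    (sym (cong₂ _+_ (cong₂ _+_ (α≡e {e = eab} a∈ b∈ a≢b ab Eab') (α≡e {e = eac} a∈ c∈ a≢c ac Eac'))
                    (α≡e {e = ebc} b∈ c∈ b≢c (trans (sym ab) ac) Ebc')))
    (EVal-sum≤2 Eab Eac Ebc (no-three-edges a∈ b∈ c∈ a≢b a≢c b≢c))
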